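{- Let $\xi$ be a ribbon. Then $\xi$ is cuspidal if and only if ${\operatorname{cont}}(\nu)\succ{\operatorname{cont}}(\xi)$ for every ${\sf SE}$-removable ribbon $\nu\subsetneq\xi$ in $\xi$.
   Context: Nodes are elements of $\mathbb{Z}\times\mathbb{Z}$; $u=(u_1,u_2)$ lies in row $u_1$ (increasing southward), column $u_2$ (increasing eastward). $u\searrow v$ means $v=u+(k,\ell)$, $k,\ell\ge0$. A finite set $\tau$ of nodes is a skew shape if $u,w\in\tau$, $u\searrow v\searrow w$ imply $v\in\tau$; connected if any two nodes are joined by a path of unit horizontal/vertical steps in $\tau$; thin if it meets each diagonal $\{u:u_2-u_1=n\}$ in at most one node. A ribbon is a nonempty thin connected skew shape. Fix $e\ge2$; $\alpha_t$ ($t\in\mathbb{Z}_e$) basis of a free $\mathbb{Z}$-module; $\alpha(t,h)=\sum_{i=0}^{h-1}\alpha_{t+\bar i}$; $\delta=\sum_t\alpha_t$; positive roots $\Phi_+=\{\alpha(t,h)\mid t\in\mathbb{Z}_e,h\in\mathbb{N}\}$; imaginary roots $m\delta$, others real. Fix a convex preorder $\succeq$ on $\Phi_+$ (reflexive, transitive, total; $\beta\succeq\gamma$, $\beta+\gamma\in\Phi_+$ imply $\beta\succeq\beta+\gamma\succeq\gamma$; ($\beta\succeq\gamma$ and $\gamma\succeq\beta$) iff $\beta=\gamma$ or both imaginary); $\succ$ strict part. $\operatorname{res}(u)=\overline{u_2-u_1}$, ${\operatorname{cont}}(\tau)=\sum_{u\in\tau}\alpha_{\operatorname{res}(u)}$;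 the content of a ribbon is a positive root. A tableau $(\lambda_1,\lambda_2)$ for a skew shape $\tau$ is a pair of disjoint nonempty skew shapes with union $\tau$ such that no $u\in\lambda_2$, $v\in\lambda_1$ satisfy $u\searrow v$. A skew shape $\mu\subseteq\tau$ is ${\sf SE}$-removable in $\tau$ if $\mu=\tau$ or $(\tau\setminus\mu,\mu)$ is a tableau for $\tau$. A skew shape $\tau$ with ${\operatorname{cont}}(\tau)=\beta\in\Phi_+$ is cuspidal if for every tableau $(\lambda_1,\lambda_2)$ for $\tau$, ${\operatorname{cont}}(\lambda_1)$ is a sum of positive roots $\prec\beta$ and ${\operatorname{cont}}(\lambda_2)$ a sum of positive roots $\succ\beta$. -}

module Defs where

open import Data.Nat as ℕ using (ℕ; zero; suc; NonZero)
open import Data.Nat.DivMod using (_mod_)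
open import Data.Integer as ℤ using (ℤ; +_; _-_)
open import Data.Integer.DivMod using (_%ℕ_)
import Data.Integer.Properties as ℤP
open import Data.Fin using (Fin)
import Data.Fin.Properties as FinP
open import Data.Vec using (Vec; tabulate; zipWith; replicate)
open import Data.List using (List; []; foldr; map; filter)
open import Data.List.Relation.Unary.All using (All)
open import Data.List.Relation.Unary.Unique.Propositional using (Unique)
open import Data.List.Membership.Propositional using (_∈_)
open import Data.List.Membership.DecPropositional using () renaming (_∈?_ to mem?)
open import Data.Product using (Σ; ∃; _×_; _,_; proj₁; proj₂)
import Data.Product.Properties as ProdP
open import Data.Sum using (_⊎_)
open import Relation.Nullary using (¬_; Dec; ¬?)
open import Relation.Binary.PropositionalEquality using (_≡_; _≢_)
open import Relation.Binary using (DecidableEquality)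
open import Function.Bundles using (_⇔_)

Node : Set
Node = ℤ × ℤ

_≟N_ : DecidableEquality Node
_≟N_ = ProdP.≡-dec ℤ._≟_ ℤ._≟_

_↘_ : Node → Node → Set
u ↘ v = (proj₁ u ℤ.≤ proj₁ v) × (proj₂ u ℤ.≤ proj₂ v)

-- Finite sets of nodes are duplicate-free lists (read up to membership)

_⊆_ : List Node → List Node → Set
μ ⊆ τ = ∀ {u} → u ∈ μ → u ∈ τ

_⊊_ : List Node → List Node → Set
μ ⊊ τ = μ ⊆ τ × ¬ (τ ⊆ μ)

_∖_ : List Node → List Node → List Node
τ ∖ μ = filter (λ u → ¬? (mem? _≟N_ u μ)) τ

NonEmpty : List Node → Set
NonEmpty τ = ∃ λ u → u ∈ τ

IsSkewShape : List Node → Set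
IsSkewShape τ = Unique τ ×
  (∀ u v w → u ∈ τ → w ∈ τ → u ↘ v → v ↘ w → v ∈ τ)

Adjacent : Node → Node → Set
Adjacent (a , b) v =
  (v ≡ (a , b ℤ.+ ℤ.1ℤ)) ⊎ (v ≡ (a , b - ℤ.1ℤ)) ⊎
  (v ≡ (a ℤ.+ ℤ.1ℤ , b)) ⊎ (v ≡ (a - ℤ.1ℤ , b))

data Path (τ : List Node) : Node → Node → Set where
  here : ∀ {u} → u ∈ τ → Path τ u u
  step : ∀ {u w v} → u ∈ τ → Adjacent u w → Path τ w v → Path τ u v

IsConnected : List Node → Set
IsConnected τ = ∀ u v → u ∈ τ → v ∈ τ → Path τ u v

IsThin : List Node → Set
IsThin τ = ∀ u v → u ∈ τ → v ∈ τ →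
  proj₂ u - proj₁ u ≡ proj₂ v - proj₁ v → u ≡ v

IsRibbon : List Node → Set
IsRibbon τ = NonEmpty τ × IsThin τ × IsConnected τ × IsSkewShape τ

-- Root lattice  ⊕_{t ∈ ℤ_e} ℤ α_t  as  Vec ℤ e  (ℤ_e = Fin e)

Root : ℕ → Set
Root e = Vec ℤ e

module _ {e : ℕ} where

  0ᵣ : Root e
  0ᵣ = replicate e (+ 0)

  _+ᵣ_ : Root e → Root e → Root e
  _+ᵣ_ = zipWith ℤ._+_

  αs : Fin e → Root e
  αs t = tabulate λ s → Data.Bool.if Relation.Nullary.Decidable.⌊ s FinP.≟ t ⌋ then + 1 else + 0
    where import Data.Bool; import Relation.Nullary.Decidable

  sumᵣ : List (Root e) → Root e
  sumᵣ = foldr _+ᵣ_ 0ᵣ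

  δ : Root e
  δ = replicate e (+ 1)

  _·δ : ℕ → Root e
  m ·δ = replicate e (+ m)

module _ {e : ℕ} .{{_ : NonZero e}} where

  shift : Fin e → ℕ → Fin e
  shift t i = (Data.Fin.toℕ t ℕ.+ i) mod e

  α : Fin e → ℕ → Root e
  α t zero    = 0ᵣ
  α t (suc h) = α t h +ᵣ αs (shift t h)

  IsPosRoot : Root e → Set
  IsPosRoot β = Σ (Fin e) λ t → Σ ℕ λ h → (1 ℕ.≤ h) × (β ≡ α t h)

  IsImaginary : Root e → Set
  IsImaginary β = Σ ℕ λ m → (1 ℕ.≤ m) × (β ≡ m ·δ)

  res : Node → Fin e
  res u = ((proj₂ u - proj₁ u) %ℕ e) mod e

  cont : List Node → Root e
  cont τ = sumᵣ (map (λ u → αs (res u)) τ)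

-- convex preorder on Φ₊ (relation given on the ambient lattice,
-- all axioms imposed on positive roots only)
record ConvexPreorder (e : ℕ) .{{_ : NonZero e}} : Set₁ where
  field
    _≽_ : Root e → Root e → Set
    refl≽  : ∀ β → IsPosRoot β → β ≽ β
    trans≽ : ∀ β γ ε → IsPosRoot β → IsPosRoot γ → IsPosRoot ε →
             β ≽ γ → γ ≽ ε → β ≽ ε
    total≽ : ∀ β γ → IsPosRoot β → IsPosRoot γ → (β ≽ γ) ⊎ (γ ≽ β)
    convex : ∀ β γ → IsPosRoot β → IsPosRoot γ → IsPosRoot (β +ᵣ γ) →
             β ≽ γ → (β ≽ (β +ᵣ γ)) × ((β +ᵣ γ) ≽ γ)
    equiv  : ∀ β γ → IsPosRoot β → IsPosRoot γ →
             ((β ≽ γ) × (γ ≽ β)) ⇔ ((β ≡ γ) ⊎ (IsImaginary β × IsImaginary γ))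

  _≻_ : Root e → Root e → Set
  β ≻ γ = (β ≽ γ) × ¬ (γ ≽ β)

module _ {e : ℕ} .{{_ : NonZero e}} (P : ConvexPreorder e) where
  open ConvexPreorder P

  SumOf : (Root e → Set) → Root e → Set
  SumOf Q x = Σ (List (Root e)) λ rs → All Q rs × (x ≡ sumᵣ rs)

  IsTableau : List Node → List Node → List Node → Set
  IsTableau τ λ₁ λ₂ =
    IsSkewShape λ₁ × IsSkewShape λ₂ × NonEmpty λ₁ × NonEmpty λ₂ ×
    (∀ u → ¬ (u ∈ λ₁ × u ∈ λ₂)) ×
    (∀ u → (u ∈ τ) ⇔ (u ∈ λ₁ ⊎ u ∈ λ₂)) ×
    (∀ u v → u ∈ λ₂ → v ∈ λ₁ → ¬ (u ↘ v))

  IsSERemovable : List Node → List Node → Set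
  IsSERemovable τ μ = IsSkewShape μ × μ ⊆ τ ×
    ((∀ u → (u ∈ μ) ⇔ (u ∈ τ)) ⊎ IsTableau τ (τ ∖ μ) μ)

  IsCuspidal : List Node → Set
  IsCuspidal τ = IsSkewShape τ × IsPosRoot (cont τ) ×
    (∀ λ₁ λ₂ → IsTableau τ λ₁ λ₂ →
       SumOf (λ γ → IsPosRoot γ × (cont τ ≻ γ)) (cont λ₁) ×
       SumOf (λ γ → IsPosRoot γ × (γ ≻ cont τ)) (cont λ₂))

module Submission where

-- Walking along a ribbon ξ from its south-west end, every step goes east or north and
-- crosses one diagonal, so each segment of the walk has content a root α(t, n) and
-- cont ξ = α(res start, |ξ|). A proper segment entered by an east step and left by a north
-- step is an SE-removable ribbon.
-- (⇒) For a proper SE-removable ribbon ν, (ξ ∖ ν, ν) is a tableau, so the positive root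
-- cont ν is a sum of roots ≻ cont ξ. Some summand starts where cont ν starts, the other
-- summands then add up to a positive root, and by induction and convexity cont ν ≻ cont ξ.
-- (⇐) Given a tableau (λ₁, λ₂), cut the walk into maximal runs inside λ₁ or inside λ₂.
-- A λ₂-run is an SE-removable ribbon, hence ≻ cont ξ. A λ₁-run D lies between a prefix A
-- and a suffix B that are SE-removable ribbons; from cont ξ = A + D + B with A, B ≻ cont ξ
-- convexity gives cont ξ ≻ D.

open import Defs
open import Data.Nat as ℕ using (ℕ; zero; suc; NonZero; z≤n; s≤s; _≤_)
import Data.Nat.Properties as ℕP
open import Data.Nat.DivMod as ℕD using (_mod_; _%_; _/_)
open import Data.Integer as ℤ using (ℤ; +_; -[1+_]; _%ℕ_; _/ℕ_)
import Data.Integer.Properties as ℤP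
import Data.Integer.DivMod as ℤD
open import Data.Integer.Tactic.RingSolver using (solve-∀)
open import Algebra.Properties.AbelianGroup ℤP.+-0-abelianGroup using (∙-cancelˡ; ∙-cancelʳ)
open import Data.Fin as Fin using (Fin; toℕ)
import Data.Fin.Properties as FinP
open import Data.Vec using ([]; _∷_; lookup; replicate; tabulate)
import Data.Vec.Properties as VecP
open import Data.List as List using (List; []; _∷_; length)
open import Data.List.Relation.Unary.All as All using (All; []; _∷_)
open import Data.List.Relation.Unary.Any using (Any; here; there)
open import Data.List.Membership.Propositional using (_∈_)
open import Data.List.Membership.Propositional.Properties using (∈-map⁺; ∈-map⁻; ∈-filter⁺; ∈-filter⁻)
open import Data.List.Membership.Propositional.Properties.WithK using (unique∧set⇒bag)
open import Data.List.Relation.Binary.BagAndSetEquality using (∼bag⇒↭)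
open import Data.List.Relation.Binary.Permutation.Propositional as Perm using (_↭_)
open import Data.List.Relation.Unary.Unique.Propositional using (Unique)
import Data.List.Relation.Unary.AllPairs as AllPairs
import Data.List.Relation.Unary.Unique.Propositional.Properties as UniqueP
import Data.List.Properties as ListP
open import Data.List.Membership.DecPropositional using () renaming (_∈?_ to mem?)
import Data.List.Extrema ℤP.≤-totalOrder as ℤExtrema
open import Data.Bool using (Bool; true; false; not; if_then_else_)
import Data.Bool.Properties as BoolP
open import Relation.Nullary using (¬_; Dec; yes; no; ¬?)
open import Relation.Nullary.Decidable using (⌊_⌋; does; dec-true; dec-false)
open import Relation.Binary.PropositionalEquality
open import Data.Product using (∃; _×_; _,_; proj₁; proj₂)
open import Data.Sum using (_⊎_; inj₁; inj₂)
open import Data.Empty using (⊥; ⊥-elim)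
open import Function.Bundles using (_⇔_; mk⇔; Equivalence)

module _ {n : ℕ} where

  +ᵣ-comm : (v w : Root n) → v +ᵣ w ≡ w +ᵣ v
  +ᵣ-comm = VecP.zipWith-comm ℤP.+-comm

  +ᵣ-assoc : (u v w : Root n) → (u +ᵣ v) +ᵣ w ≡ u +ᵣ (v +ᵣ w)
  +ᵣ-assoc = VecP.zipWith-assoc ℤP.+-assoc

  +ᵣ-identityˡ : (v : Root n) → 0ᵣ +ᵣ v ≡ v
  +ᵣ-identityˡ = VecP.zipWith-identityˡ ℤP.+-identityˡ

  +ᵣ-identityʳ : (v : Root n) → v +ᵣ 0ᵣ ≡ v
  +ᵣ-identityʳ = VecP.zipWith-identityʳ ℤP.+-identityʳ

+ᵣ-cancelˡ : {n : ℕ} (u v w : Root n) → u +ᵣ v ≡ u +ᵣ w → v ≡ w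
+ᵣ-cancelˡ [] [] [] _ = refl
+ᵣ-cancelˡ (x ∷ u) (y ∷ v) (z ∷ w) eq with VecP.∷-injective eq
... | eq₁ , eq₂ = cong₂ _∷_ (∙-cancelˡ x y z eq₁) (+ᵣ-cancelˡ u v w eq₂)

lookup-ext : {n : ℕ} {v w : Root n} → (∀ i → lookup v i ≡ lookup w i) → v ≡ w
lookup-ext {v = v} {w} p =
  trans (sym (VecP.tabulate∘lookup v)) (trans (VecP.tabulate-cong p) (VecP.tabulate∘lookup w))

lookup-+ᵣ : {n : ℕ} (v w : Root n) (i : Fin n) → lookup (v +ᵣ w) i ≡ lookup v i ℤ.+ lookup w i
lookup-+ᵣ v w i = VecP.lookup-zipWith ℤ._+_ i v w

extract : {n : ℕ} {P Q : Root n → Set} (rs : List (Root n)) → All P rs → Any Q rs →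
          ∃ λ γ → ∃ λ rest → Q γ × P γ × All P rest ×
                  sumᵣ rs ≡ γ +ᵣ sumᵣ rest × length rs ≡ suc (length rest)
extract (γ ∷ rs) (pγ ∷ ps) (here qγ) = γ , rs , qγ , pγ , ps , refl , refl
extract (ρ ∷ rs) (pρ ∷ ps) (there any) with extract rs ps any
... | γ , rest , qγ , pγ , prest , sum≡ , length≡ = γ , ρ ∷ rest , qγ , pγ , pρ ∷ prest , ρ+γ+rest , cong suc length≡
  where
  ρ+γ+rest : ρ +ᵣ sumᵣ rs ≡ γ +ᵣ (ρ +ᵣ sumᵣ rest)
  ρ+γ+rest = begin
    ρ +ᵣ sumᵣ rs               ≡⟨ cong (ρ +ᵣ_) sum≡ ⟩
    ρ +ᵣ (γ +ᵣ sumᵣ rest)      ≡⟨ +ᵣ-assoc ρ γ _ ⟨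
    (ρ +ᵣ γ) +ᵣ sumᵣ rest      ≡⟨ cong (_+ᵣ sumᵣ rest) (+ᵣ-comm ρ γ) ⟩
    (γ +ᵣ ρ) +ᵣ sumᵣ rest      ≡⟨ +ᵣ-assoc γ ρ _ ⟩
    γ +ᵣ (ρ +ᵣ sumᵣ rest)      ∎
    where open ≡-Reasoning

height : {n : ℕ} → Root n → ℤ
height [] = + 0
height (x ∷ v) = x ℤ.+ height v

height-+ᵣ : {n : ℕ} (v w : Root n) → height (v +ᵣ w) ≡ height v ℤ.+ height w
height-+ᵣ [] [] = refl
height-+ᵣ (x ∷ v) (y ∷ w) = trans (cong (λ h → x ℤ.+ y ℤ.+ h) (height-+ᵣ v w)) (middle-swap x y (height v) (height w))
  where
  middle-swap : ∀ a b c d → a ℤ.+ b ℤ.+ (c ℤ.+ d) ≡ a ℤ.+ c ℤ.+ (b ℤ.+ d)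
  middle-swap = solve-∀

height-replicate : (n : ℕ) (c : ℤ) → height (replicate n c) ≡ + n ℤ.* c
height-replicate zero c = sym (ℤP.*-zeroˡ c)
height-replicate (suc n) c = trans (cong (λ h → c ℤ.+ h) (height-replicate n c)) (sym (ℤP.suc-* (+ n) c))

height-0ᵣ : (n : ℕ) → height (0ᵣ {n}) ≡ + 0
height-0ᵣ n = trans (height-replicate n (+ 0)) (ℤP.*-zeroʳ (+ n))

indicator : {n : ℕ} → Fin n → Fin n → ℤ
indicator s t = if ⌊ s FinP.≟ t ⌋ then + 1 else + 0

indicator-≡ : {n : ℕ} {s t : Fin n} → s ≡ t → indicator s t ≡ + 1
indicator-≡ {s = s} {t} s≡t with s FinP.≟ t
... | yes _ = refl
... | no s≢t = ⊥-elim (s≢t s≡t)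

indicator-≢ : {n : ℕ} {s t : Fin n} → s ≢ t → indicator s t ≡ + 0
indicator-≢ {s = s} {t} s≢t with s FinP.≟ t
... | yes s≡t = ⊥-elim (s≢t s≡t)
... | no _ = refl

indicator-cong : {n n′ : ℕ} {s t : Fin n} {s′ t′ : Fin n′} →
                 (s ≡ t → s′ ≡ t′) → (s′ ≡ t′ → s ≡ t) → indicator s t ≡ indicator s′ t′
indicator-cong {s = s} {t} {s′} {t′} to from with s FinP.≟ t | s′ FinP.≟ t′
... | yes _ | yes _ = refl
... | no _ | no _ = refl
... | yes p | no q = ⊥-elim (q (to p))
... | no p | yes q = ⊥-elim (p (from q))

indicator-0-or-1 : {n : ℕ} (s t : Fin n) → (indicator s t ≡ + 0) ⊎ (indicator s t ≡ + 1)
indicator-0-or-1 s t with s FinP.≟ t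
... | yes _ = inj₂ refl
... | no _ = inj₁ refl

lookup-αs : {n : ℕ} (t i : Fin n) → lookup (αs t) i ≡ indicator i t
lookup-αs t i = VecP.lookup∘tabulate (λ s → indicator s t) i

height-tabulate-zero : {n : ℕ} (f : Fin n → ℤ) → (∀ i → f i ≡ + 0) → height (tabulate f) ≡ + 0
height-tabulate-zero {zero} f f≡0 = refl
height-tabulate-zero {suc n} f f≡0 =
  cong₂ ℤ._+_ (f≡0 Fin.zero) (height-tabulate-zero (λ i → f (Fin.suc i)) (λ i → f≡0 (Fin.suc i)))

height-αs : {n : ℕ} (t : Fin n) → height (αs t) ≡ + 1
height-αs {suc n} Fin.zero =
  cong (λ h → + 1 ℤ.+ h)
    (height-tabulate-zero {n} (λ s → indicator (Fin.suc s) Fin.zero) λ s → indicator-≢ {s = Fin.suc s} {Fin.zero} λ ())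
height-αs {suc n} (Fin.suc t) = cong (λ h → + 0 ℤ.+ h) tail
  where
  tail : height (tabulate (λ s → indicator (Fin.suc s) (Fin.suc t))) ≡ + 1
  tail = trans (cong height (VecP.tabulate-cong λ s → indicator-cong {s = Fin.suc s} {Fin.suc t} FinP.suc-injective (cong Fin.suc))) (height-αs t)

-- The root lattice over ℤ_e, with e = suc m

module Cyclic (m : ℕ) where

  e : ℕ
  e = suc m

  [a%e+b]%e≡[a+b]%e : ∀ a b → (a % e ℕ.+ b) % e ≡ (a ℕ.+ b) % e
  [a%e+b]%e≡[a+b]%e a b = begin
    (a % e ℕ.+ b) % e             ≡⟨ ℕD.%-distribˡ-+ (a % e) b e ⟩
    (a % e % e ℕ.+ b % e) % e     ≡⟨ cong (λ x → (x ℕ.+ b % e) % e) (ℕD.m%n%n≡m%n a e) ⟩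
    (a % e ℕ.+ b % e) % e         ≡⟨ ℕD.%-distribˡ-+ a b e ⟨
    (a ℕ.+ b) % e                 ∎
    where open ≡-Reasoning

  toℕ-shift : (t : Fin e) (i : ℕ) → toℕ (shift t i) ≡ (toℕ t ℕ.+ i) % e
  toℕ-shift t i = FinP.toℕ-fromℕ< _

  shift-zero : (t : Fin e) → shift t 0 ≡ t
  shift-zero t = FinP.toℕ-injective (begin
    toℕ (shift t 0)         ≡⟨ toℕ-shift t 0 ⟩
    (toℕ t ℕ.+ 0) % e       ≡⟨ cong (_% e) (ℕP.+-identityʳ (toℕ t)) ⟩
    toℕ t % e               ≡⟨ ℕD.m<n⇒m%n≡m (FinP.toℕ<n t) ⟩
    toℕ t                   ∎)
    where open ≡-Reasoning

  shift-shift : (t : Fin e) (i j : ℕ) → shift (shift t i) j ≡ shift t (i ℕ.+ j)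
  shift-shift t i j = FinP.toℕ-injective (begin
    toℕ (shift (shift t i) j)          ≡⟨ toℕ-shift (shift t i) j ⟩
    (toℕ (shift t i) ℕ.+ j) % e        ≡⟨ cong (λ x → (x ℕ.+ j) % e) (toℕ-shift t i) ⟩
    ((toℕ t ℕ.+ i) % e ℕ.+ j) % e      ≡⟨ [a%e+b]%e≡[a+b]%e (toℕ t ℕ.+ i) j ⟩
    (toℕ t ℕ.+ i ℕ.+ j) % e            ≡⟨ cong (_% e) (ℕP.+-assoc (toℕ t) i j) ⟩
    (toℕ t ℕ.+ (i ℕ.+ j)) % e          ≡⟨ toℕ-shift t (i ℕ.+ j) ⟨
    toℕ (shift t (i ℕ.+ j))            ∎)
    where open ≡-Reasoning

  shift-e : (t : Fin e) → shift t e ≡ t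
  shift-e t = FinP.toℕ-injective
    (trans (toℕ-shift t e) (trans (ℕD.[m+n]%n≡m%n (toℕ t) e) (ℕD.m<n⇒m%n≡m (FinP.toℕ<n t))))

  shift-surjective : (t s : Fin e) → ∃ λ j → shift t j ≡ s
  shift-surjective t s = toℕ s ℕ.+ (e ℕ.∸ toℕ t) , FinP.toℕ-injective (begin
    toℕ (shift t (toℕ s ℕ.+ (e ℕ.∸ toℕ t)))     ≡⟨ toℕ-shift t _ ⟩
    (toℕ t ℕ.+ (toℕ s ℕ.+ (e ℕ.∸ toℕ t))) % e   ≡⟨ cong (_% e) (t+[s+[e∸t]]≡s+e (ℕP.<⇒≤ (FinP.toℕ<n t))) ⟩
    (toℕ s ℕ.+ e) % e                           ≡⟨ ℕD.[m+n]%n≡m%n (toℕ s) e ⟩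
    toℕ s % e                                   ≡⟨ ℕD.m<n⇒m%n≡m (FinP.toℕ<n s) ⟩
    toℕ s                                       ∎)
    where
    open ≡-Reasoning
    t+[s+[e∸t]]≡s+e : ∀ {t s} → t ≤ e → t ℕ.+ (s ℕ.+ (e ℕ.∸ t)) ≡ s ℕ.+ e
    t+[s+[e∸t]]≡s+e {t} {s} t≤e = begin
      t ℕ.+ (s ℕ.+ (e ℕ.∸ t))   ≡⟨ ℕP.+-assoc t s _ ⟨
      t ℕ.+ s ℕ.+ (e ℕ.∸ t)     ≡⟨ cong (ℕ._+ (e ℕ.∸ t)) (ℕP.+-comm t s) ⟩
      s ℕ.+ t ℕ.+ (e ℕ.∸ t)     ≡⟨ ℕP.+-assoc s t _ ⟩
      s ℕ.+ (t ℕ.+ (e ℕ.∸ t))   ≡⟨ cong (s ℕ.+_) (ℕP.m+[n∸m]≡n t≤e) ⟩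
      s ℕ.+ e                   ∎

  shift-fixed-uniform : (t s : Fin e) (h : ℕ) → shift t h ≡ t → shift s h ≡ s
  shift-fixed-uniform t s h t-fixed with shift-surjective t s
  ... | j , refl = begin
    shift (shift t j) h    ≡⟨ shift-shift t j h ⟩
    shift t (j ℕ.+ h)      ≡⟨ cong (shift t) (ℕP.+-comm j h) ⟩
    shift t (h ℕ.+ j)      ≡⟨ shift-shift t h j ⟨
    shift (shift t h) j    ≡⟨ cong (λ u → shift u j) t-fixed ⟩
    shift t j              ∎
    where open ≡-Reasoning

  predecessor : Fin e → Fin e
  predecessor i = shift i m

  shift-1-predecessor : (i : Fin e) → shift (predecessor i) 1 ≡ i
  shift-1-predecessor i = trans (shift-shift i m 1) (trans (cong (shift i) (ℕP.+-comm m 1)) (shift-e i))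

  predecessor-shift-1 : (i : Fin e) → predecessor (shift i 1) ≡ i
  predecessor-shift-1 i = trans (shift-shift i 1 m) (shift-e i)

  α-+ : (t : Fin e) (k j : ℕ) → α t (k ℕ.+ j) ≡ α t k +ᵣ α (shift t k) j
  α-+ t k zero = trans (cong (α t) (ℕP.+-identityʳ k)) (sym (+ᵣ-identityʳ (α t k)))
  α-+ t k (suc j) = begin
    α t (k ℕ.+ suc j)                                         ≡⟨ cong (α t) (ℕP.+-suc k j) ⟩
    α t (k ℕ.+ j) +ᵣ αs (shift t (k ℕ.+ j))                   ≡⟨ cong₂ _+ᵣ_ (α-+ t k j) (cong αs (sym (shift-shift t k j))) ⟩
    (α t k +ᵣ α (shift t k) j) +ᵣ αs (shift (shift t k) j)    ≡⟨ +ᵣ-assoc (α t k) _ _ ⟩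
    α t k +ᵣ α (shift t k) (suc j)                            ∎
    where open ≡-Reasoning

  α-suc : (t : Fin e) (n : ℕ) → α t (suc n) ≡ αs t +ᵣ α (shift t 1) n
  α-suc t n = trans (α-+ t 1 n)
    (cong (_+ᵣ α (shift t 1) n) (trans (+ᵣ-identityˡ (αs (shift t 0))) (cong αs (shift-zero t))))

  height-α : (t : Fin e) (h : ℕ) → height (α t h) ≡ + h
  height-α t zero = height-0ᵣ e
  height-α t (suc h) = begin
    height (α t h +ᵣ αs (shift t h))              ≡⟨ height-+ᵣ (α t h) (αs (shift t h)) ⟩
    height (α t h) ℤ.+ height (αs (shift t h))    ≡⟨ cong₂ ℤ._+_ (height-α t h) (height-αs (shift t h)) ⟩
    + h ℤ.+ + 1                                   ≡⟨ cong +_ (ℕP.+-comm h 1) ⟩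
    + suc h                                       ∎
    where open ≡-Reasoning

  -- The discrete derivative Δ detects where a real root starts (Δ-α) and vanishes on imaginary roots.
  Δ : Root e → Fin e → ℤ
  Δ v i = lookup v i ℤ.- lookup v (predecessor i)

  Δ-+ᵣ : (v w : Root e) (i : Fin e) → Δ (v +ᵣ w) i ≡ Δ v i ℤ.+ Δ w i
  Δ-+ᵣ v w i = trans (cong₂ ℤ._-_ (lookup-+ᵣ v w i) (lookup-+ᵣ v w (predecessor i)))
                     (interchange (lookup v i) (lookup w i) (lookup v (predecessor i)) (lookup w (predecessor i)))
    where
    interchange : ∀ a b c d → a ℤ.+ b ℤ.- (c ℤ.+ d) ≡ (a ℤ.- c) ℤ.+ (b ℤ.- d)
    interchange = solve-∀

  Δ-replicate : (c : ℤ) (i : Fin e) → Δ (replicate e c) i ≡ + 0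
  Δ-replicate c i = trans (cong₂ ℤ._-_ (VecP.lookup-replicate i c) (VecP.lookup-replicate (predecessor i) c)) (ℤP.+-inverseʳ c)

  Δ-αs : (u i : Fin e) → Δ (αs u) i ≡ indicator i u ℤ.- indicator i (shift u 1)
  Δ-αs u i = cong₂ ℤ._-_ (lookup-αs u i) (trans (lookup-αs u (predecessor i))
    (indicator-cong (λ p → trans (sym (shift-1-predecessor i)) (cong (λ x → shift x 1) p))
                    (λ p → trans (cong predecessor p) (predecessor-shift-1 u))))

  Δ-α : (t : Fin e) (h : ℕ) (i : Fin e) → Δ (α t h) i ≡ indicator i t ℤ.- indicator i (shift t h)
  Δ-α t zero i = trans (Δ-replicate (+ 0) i)
    (trans (sym (ℤP.+-inverseʳ (indicator i t))) (cong (λ x → indicator i t ℤ.- indicator i x) (sym (shift-zero t))))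
  Δ-α t (suc h) i = begin
    Δ (α t h +ᵣ αs (shift t h)) i                      ≡⟨ Δ-+ᵣ (α t h) _ i ⟩
    Δ (α t h) i ℤ.+ Δ (αs (shift t h)) i               ≡⟨ cong₂ ℤ._+_ (Δ-α t h i) (Δ-αs (shift t h) i) ⟩
    (indicator i t ℤ.- indicator i (shift t h)) ℤ.+
      (indicator i (shift t h) ℤ.- indicator i (shift (shift t h) 1))
                                                       ≡⟨ ℤP.+-minus-telescope (indicator i t) _ _ ⟩
    indicator i t ℤ.- indicator i (shift (shift t h) 1) ≡⟨ cong (λ x → indicator i t ℤ.- indicator i x) shift-h-1 ⟩
    indicator i t ℤ.- indicator i (shift t (suc h))     ∎
    where
    open ≡-Reasoning
    shift-h-1 : shift (shift t h) 1 ≡ shift t (suc h)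
    shift-h-1 = trans (shift-shift t h 1) (cong (shift t) (ℕP.+-comm h 1))

  Δ-zero⇒replicate : (v : Root e) → (∀ i → Δ v i ≡ + 0) → v ≡ replicate e (lookup v Fin.zero)
  Δ-zero⇒replicate v Δv≡0 = lookup-ext λ i →
    trans (cong (lookup v) (sym (shift-zero-toℕ i)))
          (trans (constant-along-shifts (toℕ i)) (sym (VecP.lookup-replicate i _)))
    where
    shift-zero-toℕ : ∀ i → shift Fin.zero (toℕ i) ≡ i
    shift-zero-toℕ i = FinP.toℕ-injective (trans (toℕ-shift Fin.zero (toℕ i)) (ℕD.m<n⇒m%n≡m (FinP.toℕ<n i)))
    constant-along-shifts : ∀ j → lookup v (shift Fin.zero j) ≡ lookup v Fin.zero
    constant-along-shifts zero = cong (lookup v) (shift-zero Fin.zero)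
    constant-along-shifts (suc j) = trans (ℤP.i-j≡0⇒i≡j _ _ (Δv≡0 (shift Fin.zero (suc j))))
      (trans (cong (lookup v) predecessor-step) (constant-along-shifts j))
      where
      predecessor-step : predecessor (shift Fin.zero (suc j)) ≡ shift Fin.zero j
      predecessor-step = trans (cong predecessor (trans (cong (shift Fin.zero) (ℕP.+-comm 1 j)) (sym (shift-shift Fin.zero j 1))))
                               (predecessor-shift-1 (shift Fin.zero j))

  height-replicate-injective : ∀ {a b} → height (replicate e a) ≡ height (replicate e b) → a ≡ b
  height-replicate-injective {a} {b} eq =
    ℤP.*-cancelˡ-≡ (+ e) a b (trans (sym (height-replicate e a)) (trans eq (height-replicate e b)))

  Δ-zero-height-injective : (v w : Root e) → (∀ i → Δ v i ≡ + 0) → (∀ i → Δ w i ≡ + 0) →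
                            height v ≡ height w → v ≡ w
  Δ-zero-height-injective v w Δv≡0 Δw≡0 hv≡hw = begin
    v                               ≡⟨ Δ-zero⇒replicate v Δv≡0 ⟩
    replicate e (lookup v Fin.zero) ≡⟨ cong (replicate e) (height-replicate-injective heights) ⟩
    replicate e (lookup w Fin.zero) ≡⟨ Δ-zero⇒replicate w Δw≡0 ⟨
    w                               ∎
    where
    open ≡-Reasoning
    heights : height (replicate e (lookup v Fin.zero)) ≡ height (replicate e (lookup w Fin.zero))
    heights = trans (cong height (sym (Δ-zero⇒replicate v Δv≡0))) (trans hv≡hw (cong height (Δ-zero⇒replicate w Δw≡0)))

  α-periodic : (s t : Fin e) (h : ℕ) → shift t h ≡ t → α s h ≡ α t h
  α-periodic s t h t-fixed = Δ-zero-height-injective (α s h) (α t h)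
    (Δ-α-fixed s (shift-fixed-uniform t s h t-fixed)) (Δ-α-fixed t t-fixed)
    (trans (height-α s h) (sym (height-α t h)))
    where
    Δ-α-fixed : ∀ u → shift u h ≡ u → ∀ i → Δ (α u h) i ≡ + 0
    Δ-α-fixed u u-fixed i =
      trans (Δ-α u h i) (trans (cong (λ x → indicator i u ℤ.- indicator i x) u-fixed) (ℤP.+-inverseʳ (indicator i u)))

  height-posRoot : {v : Root e} → IsPosRoot v → ∃ λ h → 1 ≤ h × height v ≡ + h
  height-posRoot (t , h , 1≤h , refl) = h , 1≤h , height-α t h

  posRoot⇒≢0ᵣ : {v : Root e} → IsPosRoot v → v ≢ 0ᵣ
  posRoot⇒≢0ᵣ pv refl with height-posRoot pv
  ... | h , s≤s _ , height≡h with trans (sym height≡h) (height-0ᵣ e)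
  ... | ()

  Δ-imaginary : {v : Root e} → IsImaginary v → ∀ i → Δ v i ≡ + 0
  Δ-imaginary (n , _ , refl) = Δ-replicate (+ n)

  Δ-zero-summand : (v w : Root e) → (∀ i → Δ (v +ᵣ w) i ≡ + 0) → (∀ i → Δ w i ≡ + 0) → ∀ i → Δ v i ≡ + 0
  Δ-zero-summand v w Δv+w≡0 Δw≡0 i = begin
    Δ v i               ≡⟨ ℤP.+-identityʳ (Δ v i) ⟨
    Δ v i ℤ.+ + 0       ≡⟨ cong (λ x → Δ v i ℤ.+ x) (Δw≡0 i) ⟨
    Δ v i ℤ.+ Δ w i     ≡⟨ Δ-+ᵣ v w i ⟨
    Δ (v +ᵣ w) i        ≡⟨ Δv+w≡0 i ⟩
    + 0                 ∎
    where open ≡-Reasoning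

  Δ-zero-posRoot⇒imaginary : {v : Root e} → IsPosRoot v → (∀ i → Δ v i ≡ + 0) → IsImaginary v
  Δ-zero-posRoot⇒imaginary {v} pv Δv≡0 with height-posRoot pv
  ... | h , 1≤h , height≡h = constant (lookup v Fin.zero) refl
    where
    e*c≡h : ∀ {c} → c ≡ lookup v Fin.zero → + e ℤ.* c ≡ + h
    e*c≡h refl = trans (sym (height-replicate e _)) (trans (cong height (sym (Δ-zero⇒replicate v Δv≡0))) height≡h)
    constant : ∀ c → c ≡ lookup v Fin.zero → IsImaginary v
    constant (+ suc n) c≡v₀ = suc n , s≤s z≤n , trans (Δ-zero⇒replicate v Δv≡0) (cong (replicate e) (sym c≡v₀))
    constant -[1+ n ] c≡v₀ with e*c≡h c≡v₀
    ... | ()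
    constant (+ zero) c≡v₀ =
      ⊥-elim (ℕP.<⇒≢ 1≤h (ℤP.+-injective (trans (sym (ℤP.*-zeroʳ (+ e))) (e*c≡h c≡v₀))))

  residue : ℤ → Fin e
  residue d = (d %ℕ e) mod e

  quotient-≤ : ∀ {r r′} q q′ → r′ ℕ.< e → + r ℤ.+ q ℤ.* + e ≡ + r′ ℤ.+ q′ ℤ.* + e → q ℤ.≤ q′
  quotient-≤ {r} {r′} q q′ r′<e eq = subst (q ℤ.≤_) (pred-suc q′) (ℤP.i<j⇒i≤pred[j] q<1+q′)
    where
    pred-suc : ∀ x → ℤ.-1ℤ ℤ.+ (ℤ.1ℤ ℤ.+ x) ≡ x
    pred-suc = solve-∀
    distrib : ∀ x q → x ℤ.+ q ℤ.* x ≡ (ℤ.1ℤ ℤ.+ q) ℤ.* x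
    distrib = solve-∀
    qe<[1+q′]e : q ℤ.* + e ℤ.< (ℤ.1ℤ ℤ.+ q′) ℤ.* + e
    qe<[1+q′]e = ℤP.≤-<-trans (ℤP.i≤j+i (q ℤ.* + e) (+ r))
      (subst (ℤ._< (ℤ.1ℤ ℤ.+ q′) ℤ.* + e) (sym eq)
        (subst (λ x → + r′ ℤ.+ q′ ℤ.* + e ℤ.< x) (distrib (+ e) q′) (ℤP.+-monoˡ-< (q′ ℤ.* + e) (ℤ.+<+ r′<e))))
    q<1+q′ : q ℤ.< ℤ.1ℤ ℤ.+ q′
    q<1+q′ = ℤP.*-cancelʳ-<-nonNeg (+ e) qe<[1+q′]e

  remainder-unique : ∀ {r r′} q q′ → r ℕ.< e → r′ ℕ.< e →
                     + r ℤ.+ q ℤ.* + e ≡ + r′ ℤ.+ q′ ℤ.* + e → r ≡ r′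
  remainder-unique {r} {r′} q q′ r<e r′<e eq
    with ℤP.≤-antisym (quotient-≤ q q′ r′<e eq) (quotient-≤ q′ q r<e (sym eq))
  ... | refl = ℤP.+-injective (∙-cancelʳ (q ℤ.* + e) (+ r) (+ r′) eq)

  %ℕ-+ : ∀ d k → (d ℤ.+ + k) %ℕ e ≡ (d %ℕ e ℕ.+ k) % e
  %ℕ-+ d k = remainder-unique ((d ℤ.+ + k) /ℕ e) (d /ℕ e ℤ.+ + ((r ℕ.+ k) / e))
    (ℤD.n%ℕd<d (d ℤ.+ + k) e) (ℕD.m%n<n (r ℕ.+ k) e)
    (trans (sym (ℤD.a≡a%ℕn+[a/ℕn]*n (d ℤ.+ + k) e)) d+k≡)
    where
    r r₁ q₁ : ℕ
    r = d %ℕ e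
    r₁ = (r ℕ.+ k) % e
    q₁ = (r ℕ.+ k) / e
    q : ℤ
    q = d /ℕ e
    d+k≡ : d ℤ.+ + k ≡ + r₁ ℤ.+ (q ℤ.+ + q₁) ℤ.* + e
    d+k≡ = begin
      d ℤ.+ + k                               ≡⟨ cong (λ x → x ℤ.+ + k) (ℤD.a≡a%ℕn+[a/ℕn]*n d e) ⟩
      + r ℤ.+ q ℤ.* + e ℤ.+ + k               ≡⟨ swap (+ r) (q ℤ.* + e) (+ k) ⟩
      + r ℤ.+ + k ℤ.+ q ℤ.* + e               ≡⟨ cong (λ x → x ℤ.+ q ℤ.* + e) (sym (ℤP.pos-+ r k)) ⟩
      + (r ℕ.+ k) ℤ.+ q ℤ.* + e               ≡⟨ cong (λ x → + x ℤ.+ q ℤ.* + e) (ℕD.m≡m%n+[m/n]*n (r ℕ.+ k) e) ⟩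
      + (r₁ ℕ.+ q₁ ℕ.* e) ℤ.+ q ℤ.* + e       ≡⟨ cong (λ x → x ℤ.+ q ℤ.* + e) (trans (ℤP.pos-+ r₁ (q₁ ℕ.* e)) (cong (λ x → + r₁ ℤ.+ x) (ℤP.pos-* q₁ e))) ⟩
      + r₁ ℤ.+ + q₁ ℤ.* + e ℤ.+ q ℤ.* + e     ≡⟨ collect (+ r₁) (+ q₁) q (+ e) ⟩
      + r₁ ℤ.+ (q ℤ.+ + q₁) ℤ.* + e           ∎
      where
      open ≡-Reasoning
      swap : ∀ a b c → a ℤ.+ b ℤ.+ c ≡ a ℤ.+ c ℤ.+ b
      swap = solve-∀
      collect : ∀ a b c x → a ℤ.+ b ℤ.* x ℤ.+ c ℤ.* x ≡ a ℤ.+ (c ℤ.+ b) ℤ.* x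
      collect = solve-∀

  residue-+ : ∀ d k → residue (d ℤ.+ + k) ≡ shift (residue d) k
  residue-+ d k = FinP.toℕ-injective (begin
    toℕ (residue (d ℤ.+ + k))         ≡⟨ FinP.toℕ-fromℕ< _ ⟩
    (d ℤ.+ + k) %ℕ e % e              ≡⟨ ℕD.m<n⇒m%n≡m (ℤD.n%ℕd<d (d ℤ.+ + k) e) ⟩
    (d ℤ.+ + k) %ℕ e                  ≡⟨ %ℕ-+ d k ⟩
    (d %ℕ e ℕ.+ k) % e                ≡⟨ cong (λ x → (x ℕ.+ k) % e) (sym toℕ-residue) ⟩
    (toℕ (residue d) ℕ.+ k) % e       ≡⟨ toℕ-shift (residue d) k ⟨
    toℕ (shift (residue d) k)         ∎)
    where
    open ≡-Reasoning
    toℕ-residue : toℕ (residue d) ≡ d %ℕ e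
    toℕ-residue = trans (FinP.toℕ-fromℕ< _) (ℕD.m<n⇒m%n≡m (ℤD.n%ℕd<d d e))

  height-sumᵣ-posRoots : (rs : List (Root e)) → All IsPosRoot rs → ∃ λ n → length rs ≤ n × height (sumᵣ rs) ≡ + n
  height-sumᵣ-posRoots [] [] = 0 , z≤n , height-0ᵣ e
  height-sumᵣ-posRoots (γ ∷ rs) (pγ ∷ ps) with height-posRoot pγ | height-sumᵣ-posRoots rs ps
  ... | h , 1≤h , height-γ | n , length≤n , height-rs =
    h ℕ.+ n , ℕP.+-mono-≤ 1≤h length≤n ,
    trans (height-+ᵣ γ (sumᵣ rs)) (trans (cong₂ ℤ._+_ height-γ height-rs) (sym (ℤP.pos-+ h n)))

  α-remainder : (t : Fin e) (k h n : ℕ) (σ : Root e) → α t h ≡ α t k +ᵣ σ → height σ ≡ + n →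
                σ ≡ α (shift t k) n
  α-remainder t k h n σ α-split height-σ = +ᵣ-cancelˡ (α t k) σ _ (begin
    α t k +ᵣ σ                ≡⟨ α-split ⟨
    α t h                     ≡⟨ cong (α t) h≡k+n ⟩
    α t (k ℕ.+ n)             ≡⟨ α-+ t k n ⟩
    α t k +ᵣ α (shift t k) n  ∎)
    where
    open ≡-Reasoning
    h≡k+n : h ≡ k ℕ.+ n
    h≡k+n = ℤP.+-injective (begin
      + h                               ≡⟨ height-α t h ⟨
      height (α t h)                    ≡⟨ cong height α-split ⟩
      height (α t k +ᵣ σ)               ≡⟨ height-+ᵣ (α t k) σ ⟩
      height (α t k) ℤ.+ height σ       ≡⟨ cong₂ ℤ._+_ (height-α t k) height-σ ⟩
      + k ℤ.+ + n                       ≡⟨ ℤP.pos-+ k n ⟨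
      + (k ℕ.+ n)                       ∎)

  Δ-α-positive⇒starts-at : {γ : Root e} {t : Fin e} → IsPosRoot γ → + 1 ℤ.≤ Δ γ t → ∃ λ k → γ ≡ α t k
  Δ-α-positive⇒starts-at {t = t} (s , k , _ , refl) 1≤Δ with t FinP.≟ s
  ... | yes refl = k , refl
  ... | no t≢s = ⊥-elim (0-x≰1 (indicator-0-or-1 t (shift s k)) (subst (+ 1 ℤ.≤_) Δ≡0-x 1≤Δ))
    where
    Δ≡0-x : Δ (α s k) t ≡ + 0 ℤ.- indicator t (shift s k)
    Δ≡0-x = trans (Δ-α s k t) (cong (λ x → x ℤ.- indicator t (shift s k)) (indicator-≢ t≢s))
    0-x≰1 : ∀ {x} → (x ≡ + 0) ⊎ (x ≡ + 1) → ¬ (+ 1 ℤ.≤ + 0 ℤ.- x)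
    0-x≰1 (inj₁ refl) (ℤ.+≤+ ())
    0-x≰1 (inj₂ refl) ()

  StartsAt : Fin e → Root e → Set
  StartsAt t γ = ∃ λ k → γ ≡ α t k

  Δ-positive⇒summand-starts-at : {t : Fin e} (rs : List (Root e)) → All IsPosRoot rs →
                                 + 1 ℤ.≤ Δ (sumᵣ rs) t → Any (StartsAt t) rs
  Δ-positive⇒summand-starts-at {t} [] [] 1≤Δ with subst (+ 1 ℤ.≤_) (Δ-replicate (+ 0) t) 1≤Δ
  ... | ℤ.+≤+ ()
  Δ-positive⇒summand-starts-at {t} (γ ∷ rs) (pγ ∷ ps) 1≤Δ with Δ γ t ℤ.≤? + 0
  ... | no Δγ≰0 = here (Δ-α-positive⇒starts-at pγ (ℤP.i<j⇒suc[i]≤j (ℤP.≰⇒> Δγ≰0)))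
  ... | yes Δγ≤0 = there (Δ-positive⇒summand-starts-at rs ps (ℤP.≤-trans 1≤Δ Δ-bound))
    where
    Δ-bound : Δ (γ +ᵣ sumᵣ rs) t ℤ.≤ Δ (sumᵣ rs) t
    Δ-bound = begin
      Δ (γ +ᵣ sumᵣ rs) t             ≡⟨ Δ-+ᵣ γ (sumᵣ rs) t ⟩
      Δ γ t ℤ.+ Δ (sumᵣ rs) t        ≤⟨ ℤP.+-monoˡ-≤ (Δ (sumᵣ rs) t) Δγ≤0 ⟩
      + 0 ℤ.+ Δ (sumᵣ rs) t          ≡⟨ ℤP.+-identityˡ _ ⟩
      Δ (sumᵣ rs) t                  ∎
      where open ℤP.≤-Reasoning

  initial-summand : {t : Fin e} {h : ℕ} (rs : List (Root e)) → All IsPosRoot rs → rs ≢ [] → sumᵣ rs ≡ α t h →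
                    ∃ λ t′ → sumᵣ rs ≡ α t′ h × Any (StartsAt t′) rs
  initial-summand [] _ []≢[] _ = ⊥-elim ([]≢[] refl)
  initial-summand {t} {h} rs@(γ ∷ _) ps@(pγ ∷ _) _ rs≡α with shift t h FinP.≟ t
  ... | yes t-fixed with pγ
  ...   | s , k , _ , γ≡α = s , trans rs≡α (sym (α-periodic s t h t-fixed)) , here (k , γ≡α)
  initial-summand {t} {h} rs ps _ rs≡α | no t-moved =
    t , rs≡α , Δ-positive⇒summand-starts-at rs ps (ℤP.≤-reflexive (sym Δ≡1))
    where
    Δ≡1 : Δ (sumᵣ rs) t ≡ + 1
    Δ≡1 = begin
      Δ (sumᵣ rs) t                                   ≡⟨ cong (λ v → Δ v t) rs≡α ⟩
      Δ (α t h) t                                     ≡⟨ Δ-α t h t ⟩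
      indicator t t ℤ.- indicator t (shift t h)       ≡⟨ cong₂ ℤ._-_ (indicator-≡ {s = t} refl) (indicator-≢ (λ t≡ → t-moved (sym t≡))) ⟩
      + 1                                             ∎
      where open ≡-Reasoning

-- Convex preorders

module ConvexOrder (m : ℕ) (P : ConvexPreorder (suc m)) where
  open Cyclic m
  open ConvexPreorder P

  ≽-≻-trans : {ρ σ β : Root e} → IsPosRoot ρ → IsPosRoot σ → IsPosRoot β → ρ ≽ σ → σ ≻ β → ρ ≻ β
  ≽-≻-trans {ρ} {σ} {β} pρ pσ pβ ρ≽σ (σ≽β , β⋡σ) =
    trans≽ ρ σ β pρ pσ pβ ρ≽σ σ≽β , λ β≽ρ → β⋡σ (trans≽ β ρ σ pβ pρ pσ β≽ρ ρ≽σ)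

  ≻-≽-trans : {β ρ σ : Root e} → IsPosRoot β → IsPosRoot ρ → IsPosRoot σ → β ≻ ρ → ρ ≽ σ → β ≻ σ
  ≻-≽-trans {β} {ρ} {σ} pβ pρ pσ (β≽ρ , ρ⋡β) ρ≽σ =
    trans≽ β ρ σ pβ pρ pσ β≽ρ ρ≽σ , λ σ≽β → ρ⋡β (trans≽ ρ σ β pρ pσ pβ ρ≽σ σ≽β)

  ≻-trans : {β ρ σ : Root e} → IsPosRoot β → IsPosRoot ρ → IsPosRoot σ → β ≻ ρ → ρ ≻ σ → β ≻ σ
  ≻-trans pβ pρ pσ β≻ρ ρ≻σ = ≻-≽-trans pβ pρ pσ β≻ρ (proj₁ ρ≻σ)

  sum-≽-smaller-summand : {γ σ : Root e} → IsPosRoot γ → IsPosRoot σ → IsPosRoot (γ +ᵣ σ) →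
                          ((γ +ᵣ σ) ≽ γ) ⊎ ((γ +ᵣ σ) ≽ σ)
  sum-≽-smaller-summand {γ} {σ} pγ pσ pγ+σ with total≽ γ σ pγ pσ
  ... | inj₁ γ≽σ = inj₂ (proj₂ (convex γ σ pγ pσ pγ+σ γ≽σ))
  ... | inj₂ σ≽γ = inj₁ (subst (_≽ γ) (+ᵣ-comm σ γ) (proj₂ (convex σ γ pσ pγ (subst IsPosRoot (+ᵣ-comm γ σ) pγ+σ) σ≽γ)))

  +ᵣ-≻ : {γ σ β : Root e} → IsPosRoot γ → IsPosRoot σ → IsPosRoot β → IsPosRoot (γ +ᵣ σ) →
         γ ≻ β → σ ≻ β → (γ +ᵣ σ) ≻ β
  +ᵣ-≻ pγ pσ pβ pγ+σ γ≻β σ≻β with sum-≽-smaller-summand pγ pσ pγ+σ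
  ... | inj₁ sum≽γ = ≽-≻-trans pγ+σ pγ pβ sum≽γ γ≻β
  ... | inj₂ sum≽σ = ≽-≻-trans pγ+σ pσ pβ sum≽σ σ≻β

  summand-above⇒summand-below : {β γ δ : Root e} → IsPosRoot β → IsPosRoot γ → IsPosRoot δ →
                                β ≡ γ +ᵣ δ → γ ≻ β → β ≻ δ
  summand-above⇒summand-below {β} {γ} {δ} pβ pγ pδ refl (γ≽β , β⋡γ) with total≽ δ γ pδ pγ
  ... | inj₁ δ≽γ = ⊥-elim (β⋡γ (subst (_≽ γ) (+ᵣ-comm δ γ) (proj₂ (convex δ γ pδ pγ (subst IsPosRoot (+ᵣ-comm γ δ) pβ) δ≽γ))))
  ... | inj₂ γ≽δ = β≽δ , δ⋡β
    where
    β≽δ : β ≽ δ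
    β≽δ = proj₂ (convex γ δ pγ pδ pβ γ≽δ)
    δ⋡β : ¬ (δ ≽ β)
    δ⋡β δ≽β with Equivalence.to (equiv δ β pδ pβ) (δ≽β , β≽δ)
    ... | inj₁ δ≡β = posRoot⇒≢0ᵣ pγ (+ᵣ-cancelˡ δ γ 0ᵣ (trans (+ᵣ-comm δ γ) (trans (sym δ≡β) (sym (+ᵣ-identityʳ δ)))))
    ... | inj₂ (δ-imaginary , β-imaginary) = β⋡γ (proj₂ (Equivalence.from (equiv γ β pγ pβ) (inj₂ (γ-imaginary , β-imaginary))))
      where
      γ-imaginary : IsImaginary γ
      γ-imaginary = Δ-zero-posRoot⇒imaginary pγ (Δ-zero-summand γ δ (Δ-imaginary β-imaginary) (Δ-imaginary δ-imaginary))

  middle-below : {β γ δ ε : Root e} → IsPosRoot β → IsPosRoot γ → IsPosRoot δ → IsPosRoot ε → IsPosRoot (δ +ᵣ ε) →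
                 β ≡ γ +ᵣ (δ +ᵣ ε) → γ ≻ β → ε ≻ β → β ≻ δ
  middle-below {β} {δ = δ} {ε} pβ pγ pδ pε pδ+ε β≡ γ≻β ε≻β = ≻-trans pβ pδ+ε pδ β≻δ+ε δ+ε≻δ
    where
    β≻δ+ε : β ≻ (δ +ᵣ ε)
    β≻δ+ε = summand-above⇒summand-below pβ pγ pδ+ε β≡ γ≻β
    δ+ε≻δ : (δ +ᵣ ε) ≻ δ
    δ+ε≻δ = summand-above⇒summand-below pδ+ε pε pδ (+ᵣ-comm δ ε) (≻-trans pε pβ pδ+ε ε≻β β≻δ+ε)

  Above : Root e → Root e → Set
  Above β γ = IsPosRoot γ × γ ≻ β

  Below : Root e → Root e → Set
  Below β γ = IsPosRoot γ × β ≻ γ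

  sum-of-above⇒above : {β : Root e} → IsPosRoot β → (rs : List (Root e)) →
                       All (Above β) rs → IsPosRoot (sumᵣ rs) → sumᵣ rs ≻ β
  sum-of-above⇒above {β} pβ rs = bounded (length rs) rs ℕP.≤-refl
    where
    bounded : ∀ n rs → length rs ≤ n → All (Above β) rs → IsPosRoot (sumᵣ rs) → sumᵣ rs ≻ β
    bounded _ [] _ _ prs = ⊥-elim (posRoot⇒≢0ᵣ prs refl)
    bounded _ (γ ∷ []) _ (aγ ∷ []) _ = subst (_≻ β) (sym (+ᵣ-identityʳ γ)) (proj₂ aγ)
    bounded (suc n) rs@(_ ∷ ρ ∷ ρs) (s≤s length≤n) above prs@(t , h , _ , rs≡α)
      with initial-summand {t} {h} rs (All.map proj₁ above) (λ ()) rs≡α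
    ... | t′ , rs≡α′ , start with extract rs above start
    ... | γ , rest , (k , γ≡α) , (pγ , γ≻β) , arest , rs≡γ+rest , length≡ =
      subst (_≻ β) (sym rs≡γ+rest)
        (+ᵣ-≻ pγ prest pβ (subst IsPosRoot rs≡γ+rest prs) γ≻β (bounded n rest rest≤n arest prest))
      where
      length-rest : length rest ≡ suc (length ρs)
      length-rest = sym (ℕP.suc-injective length≡)
      rest≤n : length rest ≤ n
      rest≤n = subst (_≤ n) (sym length-rest) length≤n
      prest : IsPosRoot (sumᵣ rest)
      prest with height-sumᵣ-posRoots rest (All.map proj₁ arest)
      ... | n′ , rest≤n′ , height-rest =
        shift t′ k , n′ , ℕP.≤-trans (s≤s z≤n) (subst (_≤ n′) length-rest rest≤n′) ,
        α-remainder t′ k h n′ (sumᵣ rest) (trans (sym rs≡α′) (trans rs≡γ+rest (cong (_+ᵣ sumᵣ rest) γ≡α))) height-rest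

-- Ribbons as lattice walks

diag : Node → ℤ
diag u = proj₂ u ℤ.- proj₁ u

east north : Node → Node
east u = (proj₁ u , proj₂ u ℤ.+ ℤ.1ℤ)
north u = (proj₁ u ℤ.- ℤ.1ℤ , proj₂ u)

move : Bool → Node → Node
move true = east
move false = north

walk : Node → (ℕ → Bool) → ℕ → Node
walk s dir zero = s
walk s dir (suc k) = move (dir k) (walk s dir k)

easts norths : (ℕ → Bool) → ℕ → ℕ
easts dir zero = 0
easts dir (suc k) = if dir k then suc (easts dir k) else easts dir k
norths dir zero = 0
norths dir (suc k) = if dir k then norths dir k else suc (norths dir k)

diag-move : ∀ b u → diag (move b u) ≡ diag u ℤ.+ ℤ.1ℤ
diag-move true (a , b) = ring-identity a b
  where
  ring-identity : ∀ a b → b ℤ.+ ℤ.1ℤ ℤ.- a ≡ b ℤ.- a ℤ.+ ℤ.1ℤ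
  ring-identity = solve-∀
diag-move false (a , b) = ring-identity a b
  where
  ring-identity : ∀ a b → b ℤ.- (a ℤ.- ℤ.1ℤ) ≡ b ℤ.- a ℤ.+ ℤ.1ℤ
  ring-identity = solve-∀

diag-walk : ∀ s dir k → diag (walk s dir k) ≡ diag s ℤ.+ + k
diag-walk s dir zero = sym (ℤP.+-identityʳ (diag s))
diag-walk s dir (suc k) = begin
  diag (move (dir k) (walk s dir k))    ≡⟨ diag-move (dir k) (walk s dir k) ⟩
  diag (walk s dir k) ℤ.+ ℤ.1ℤ          ≡⟨ cong (λ x → x ℤ.+ ℤ.1ℤ) (diag-walk s dir k) ⟩
  diag s ℤ.+ + k ℤ.+ ℤ.1ℤ               ≡⟨ ℤP.+-assoc (diag s) (+ k) ℤ.1ℤ ⟩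
  diag s ℤ.+ (+ k ℤ.+ ℤ.1ℤ)             ≡⟨ cong (λ x → diag s ℤ.+ + x) (ℕP.+-comm k 1) ⟩
  diag s ℤ.+ + suc k                    ∎
  where open ≡-Reasoning

walk-injective : ∀ s dir {k l} → walk s dir k ≡ walk s dir l → k ≡ l
walk-injective s dir {k} {l} eq = ℤP.+-injective (∙-cancelˡ (diag s) (+ k) (+ l)
  (trans (sym (diag-walk s dir k)) (trans (cong diag eq) (diag-walk s dir l))))

row-walk : ∀ s dir k → proj₁ (walk s dir k) ≡ proj₁ s ℤ.- + norths dir k
row-walk s dir zero = sym (ℤP.+-identityʳ (proj₁ s))
row-walk s dir (suc k) with dir k
... | true = row-walk s dir k
... | false = trans (cong (λ x → x ℤ.- ℤ.1ℤ) (row-walk s dir k)) (regroup (proj₁ s) (+ norths dir k))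
  where
  regroup : ∀ r x → r ℤ.- x ℤ.- ℤ.1ℤ ≡ r ℤ.- (ℤ.1ℤ ℤ.+ x)
  regroup = solve-∀

col-walk : ∀ s dir k → proj₂ (walk s dir k) ≡ proj₂ s ℤ.+ + easts dir k
col-walk s dir zero = sym (ℤP.+-identityʳ (proj₂ s))
col-walk s dir (suc k) with dir k
... | true = trans (cong (λ x → x ℤ.+ ℤ.1ℤ) (col-walk s dir k)) (regroup (proj₂ s) (+ easts dir k))
  where
  regroup : ∀ r x → r ℤ.+ x ℤ.+ ℤ.1ℤ ≡ r ℤ.+ (ℤ.1ℤ ℤ.+ x)
  regroup = solve-∀
... | false = col-walk s dir k

ℤ-+-cancelˡ-≤ : ∀ r {a b} → r ℤ.+ a ℤ.≤ r ℤ.+ b → a ℤ.≤ b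
ℤ-+-cancelˡ-≤ r {a} {b} le = subst₂ ℤ._≤_ (cancel r a) (cancel r b) (ℤP.+-monoʳ-≤ (ℤ.- r) le)
  where
  cancel : ∀ r a → ℤ.- r ℤ.+ (r ℤ.+ a) ≡ a
  cancel = solve-∀

suc-monotone⇒monotone : (f : ℕ → ℕ) → (∀ k → f k ≤ f (suc k)) → ∀ {k l} → k ≤ l → f k ≤ f l
suc-monotone⇒monotone f f-suc {k} k≤l with ℕP.m≤n⇒∃[o]m+o≡n k≤l
... | o , refl = go o
  where
  go : ∀ o → f k ≤ f (k ℕ.+ o)
  go zero = ℕP.≤-reflexive (cong f (sym (ℕP.+-identityʳ k)))
  go (suc o) = ℕP.≤-trans (go o) (subst (λ x → f (k ℕ.+ o) ≤ f x) (sym (ℕP.+-suc k o)) (f-suc (k ℕ.+ o)))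

easts-monotone : ∀ dir {k l} → k ≤ l → easts dir k ≤ easts dir l
easts-monotone dir = suc-monotone⇒monotone (easts dir) easts-suc
  where
  easts-suc : ∀ k → easts dir k ≤ easts dir (suc k)
  easts-suc k with dir k
  ... | true = ℕP.n≤1+n _
  ... | false = ℕP.≤-refl

norths-monotone : ∀ dir {k l} → k ≤ l → norths dir k ≤ norths dir l
norths-monotone dir = suc-monotone⇒monotone (norths dir) norths-suc
  where
  norths-suc : ∀ k → norths dir k ≤ norths dir (suc k)
  norths-suc k with dir k
  ... | true = ℕP.≤-refl
  ... | false = ℕP.n≤1+n _

easts-east : ∀ dir k → dir k ≡ true → easts dir (suc k) ≡ suc (easts dir k)
easts-east dir k dir-k rewrite dir-k = refl

norths-north : ∀ dir k → dir k ≡ false → norths dir (suc k) ≡ suc (norths dir k)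
norths-north dir k dir-k rewrite dir-k = refl

walk-↘⇒counts : ∀ s dir k l → walk s dir k ↘ walk s dir l →
                norths dir l ≤ norths dir k × easts dir k ≤ easts dir l
walk-↘⇒counts s dir k l (row≤ , col≤) =
  ℤP.drop‿+≤+ (ℤP.neg-cancel-≤ (ℤ-+-cancelˡ-≤ (proj₁ s) (subst₂ ℤ._≤_ (row-walk s dir k) (row-walk s dir l) row≤))) ,
  ℤP.drop‿+≤+ (ℤ-+-cancelˡ-≤ (proj₂ s) (subst₂ ℤ._≤_ (col-walk s dir k) (col-walk s dir l) col≤))

east-between⇒¬↘ : ∀ s dir {k i l} → k ≤ i → i ℕ.< l → dir i ≡ true → ¬ (walk s dir l ↘ walk s dir k)
east-between⇒¬↘ s dir {k} {i} {l} k≤i i<l dir-i l↘k = ℕP.<⇒≱ easts-k<easts-l (proj₂ (walk-↘⇒counts s dir l k l↘k))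
  where
  easts-k<easts-l : easts dir k ℕ.< easts dir l
  easts-k<easts-l = ℕP.<-≤-trans (s≤s (easts-monotone dir k≤i))
    (subst (ℕ._≤ easts dir l) (easts-east dir i dir-i) (easts-monotone dir i<l))

north-between⇒¬↘ : ∀ s dir {l j k} → l ≤ j → j ℕ.< k → dir j ≡ false → ¬ (walk s dir l ↘ walk s dir k)
north-between⇒¬↘ s dir {l} {j} {k} l≤j j<k dir-j l↘k = ℕP.<⇒≱ norths-l<norths-k (proj₁ (walk-↘⇒counts s dir l k l↘k))
  where
  norths-l<norths-k : norths dir l ℕ.< norths dir k
  norths-l<norths-k = ℕP.<-≤-trans (s≤s (norths-monotone dir l≤j))
    (subst (ℕ._≤ norths dir k) (norths-north dir j dir-j) (norths-monotone dir j<k))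

east-move-↘ : ∀ s dir k → dir k ≡ true → walk s dir k ↘ walk s dir (suc k)
east-move-↘ s dir k dir-k rewrite dir-k = ℤP.≤-refl , ℤP.i≤i+j (proj₂ (walk s dir k)) ℤ.1ℤ

north-move-↘ : ∀ s dir k → dir k ≡ false → walk s dir (suc k) ↘ walk s dir k
north-move-↘ s dir k dir-k rewrite dir-k = ℤP.i-j≤i (proj₁ (walk s dir k)) ℤ.1ℤ , ℤP.≤-refl

adjacent-move : ∀ b u → Adjacent u (move b u)
adjacent-move true u = inj₁ refl
adjacent-move false u = inj₂ (inj₂ (inj₂ refl))

adjacent-move⁻¹ : ∀ b u → Adjacent (move b u) u
adjacent-move⁻¹ true (a , b) = inj₂ (inj₁ (cong (a ,_) (ring-identity b)))
  where
  ring-identity : ∀ b → b ≡ b ℤ.+ ℤ.1ℤ ℤ.- ℤ.1ℤ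
  ring-identity = solve-∀
adjacent-move⁻¹ false (a , b) = inj₂ (inj₂ (inj₁ (cong (_, b) (ring-identity a))))
  where
  ring-identity : ∀ a → a ≡ a ℤ.- ℤ.1ℤ ℤ.+ ℤ.1ℤ
  ring-identity = solve-∀

adjacent⇒move-or-diag-pred : ∀ u w → Adjacent u w → (∃ λ b → w ≡ move b u) ⊎ (diag w ≡ diag u ℤ.- ℤ.1ℤ)
adjacent⇒move-or-diag-pred u w (inj₁ refl) = inj₁ (true , refl)
adjacent⇒move-or-diag-pred (a , b) w (inj₂ (inj₁ refl)) = inj₂ (ring-identity a b)
  where
  ring-identity : ∀ a b → b ℤ.- ℤ.1ℤ ℤ.- a ≡ b ℤ.- a ℤ.- ℤ.1ℤ
  ring-identity = solve-∀
adjacent⇒move-or-diag-pred (a , b) w (inj₂ (inj₂ (inj₁ refl))) = inj₂ (ring-identity a b)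
  where
  ring-identity : ∀ a b → b ℤ.- (a ℤ.+ ℤ.1ℤ) ≡ b ℤ.- a ℤ.- ℤ.1ℤ
  ring-identity = solve-∀
adjacent⇒move-or-diag-pred u w (inj₂ (inj₂ (inj₂ refl))) = inj₁ (false , refl)

path-start : ∀ {τ u v} → Path τ u v → u ∈ τ
path-start (here u∈τ) = u∈τ
path-start (step u∈τ _ _) = u∈τ

path-crosses-diagonal : ∀ {τ u v} → Path τ u v → (d : ℤ) → diag u ℤ.≤ d → d ℤ.< diag v →
                        ∃ λ a → ∃ λ b → a ∈ τ × b ∈ τ × Adjacent a b × diag a ≡ d × diag b ≡ d ℤ.+ ℤ.1ℤ
path-crosses-diagonal (here _) d u≤d d<u = ⊥-elim (ℤP.<-irrefl refl (ℤP.≤-<-trans u≤d d<u))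
path-crosses-diagonal {u = u} (step {w = w} u∈τ adj path) d u≤d d<v with adjacent⇒move-or-diag-pred u w adj
... | inj₂ w-diag = path-crosses-diagonal path d (ℤP.≤-trans (subst (ℤ._≤ diag u) (sym w-diag) (ℤP.i-j≤i (diag u) ℤ.1ℤ)) u≤d) d<v
... | inj₁ (b , refl) with diag u ℤ.≟ d
...   | yes refl = u , move b u , u∈τ , path-start path , adj , refl , diag-move b u
...   | no u≢d = path-crosses-diagonal path d w≤d d<v
  where
  w≤d : diag (move b u) ℤ.≤ d
  w≤d = subst (ℤ._≤ d) (sym (trans (diag-move b u) (ℤP.+-comm (diag u) ℤ.1ℤ))) (ℤP.i<j⇒suc[i]≤j (ℤP.≤∧≢⇒< u≤d u≢d))

diag-minimum : (ξ : List Node) → NonEmpty ξ → ∃ λ s → s ∈ ξ × (∀ v → v ∈ ξ → diag s ℤ.≤ diag v)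
diag-minimum [] (_ , ())
diag-minimum (x ∷ xs) _ = s , s∈ , minimal
  where
  s : Node
  s = ℤExtrema.argmin diag x xs
  s∈ : s ∈ x ∷ xs
  s∈ with ℤExtrema.argmin-sel diag x xs
  ... | inj₁ s≡x = here s≡x
  ... | inj₂ s∈xs = there s∈xs
  minimal : ∀ v → v ∈ x ∷ xs → diag s ℤ.≤ diag v
  minimal v (here refl) = ℤExtrema.f[argmin]≤f[⊤] {f = diag} x xs
  minimal v (there v∈xs) = All.lookup (ℤExtrema.f[argmin]≤f[xs] {f = diag} x xs) v∈xs

diag-maximum : (ξ : List Node) → NonEmpty ξ → ∃ λ M → M ∈ ξ × (∀ v → v ∈ ξ → diag v ℤ.≤ diag M)
diag-maximum [] (_ , ())
diag-maximum (x ∷ xs) _ = M , M∈ , maximal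
  where
  M : Node
  M = ℤExtrema.argmax diag x xs
  M∈ : M ∈ x ∷ xs
  M∈ with ℤExtrema.argmax-sel diag x xs
  ... | inj₁ M≡x = here M≡x
  ... | inj₂ M∈xs = there M∈xs
  maximal : ∀ v → v ∈ x ∷ xs → diag v ℤ.≤ diag M
  maximal v (here refl) = ℤExtrema.f[⊥]≤f[argmax] {f = diag} x xs
  maximal v (there v∈xs) = All.lookup (ℤExtrema.f[xs]≤f[argmax] {f = diag} x xs) v∈xs

≤⇒+ℕ : ∀ a b → a ℤ.≤ b → ∃ λ n → b ≡ a ℤ.+ + n
≤⇒+ℕ a b a≤b = ℤ.∣ b ℤ.- a ∣ , trans (ring-identity a b) (cong (λ x → a ℤ.+ x) (sym (ℤP.0≤i⇒+∣i∣≡i (ℤP.i≤j⇒0≤j-i a≤b))))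
  where
  ring-identity : ∀ a b → b ≡ a ℤ.+ (b ℤ.- a)
  ring-identity = solve-∀

record RibbonWalk (ξ : List Node) : Set where
  field
    start : Node
    dir : ℕ → Bool
    size : ℕ
    1≤size : 1 ≤ size
    walk-∈ : ∀ k → k ℕ.< size → walk start dir k ∈ ξ
    ∈⇒walk : ∀ u → u ∈ ξ → ∃ λ k → k ℕ.< size × u ≡ walk start dir k

-- A thin connected ξ meets every diagonal between its extreme ones exactly once, so it is
-- traced by the walk from its lowest diagonal that moves east whenever it can.
module GreedyWalk (ξ : List Node) (thin : IsThin ξ) (connected : IsConnected ξ)
                  (s : Node) (s∈ξ : s ∈ ξ) (s-minimal : ∀ v → v ∈ ξ → diag s ℤ.≤ diag v)
                  (M : Node) (M∈ξ : M ∈ ξ) (M-maximal : ∀ v → v ∈ ξ → diag v ℤ.≤ diag M) where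

  eastward : Node → Bool
  eastward u = does (mem? _≟N_ (east u) ξ)

  greedy : ℕ → Node
  greedy zero = s
  greedy (suc k) = move (eastward (greedy k)) (greedy k)

  dir : ℕ → Bool
  dir k = eastward (greedy k)

  greedy≡walk : ∀ k → greedy k ≡ walk s dir k
  greedy≡walk zero = refl
  greedy≡walk (suc k) = cong (move (dir k)) (greedy≡walk k)

  diag-greedy : ∀ k → diag (greedy k) ≡ diag s ℤ.+ + k
  diag-greedy k = trans (cong diag (greedy≡walk k)) (diag-walk s dir k)

  n : ℕ
  n = proj₁ (≤⇒+ℕ (diag s) (diag M) (s-minimal M M∈ξ))

  diag-M : diag M ≡ diag s ℤ.+ + n
  diag-M = proj₂ (≤⇒+ℕ (diag s) (diag M) (s-minimal M M∈ξ))

  eastward-move-∈ : ∀ u b → move b u ∈ ξ → move (eastward u) u ∈ ξ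
  eastward-move-∈ u true east∈ with mem? _≟N_ (east u) ξ
  ... | yes _ = east∈
  ... | no east∉ = ⊥-elim (east∉ east∈)
  eastward-move-∈ u false north∈ with mem? _≟N_ (east u) ξ
  ... | yes east∈ = east∈
  ... | no _ = north∈

  greedy-∈ : ∀ k → k ≤ n → greedy k ∈ ξ
  greedy-∈ zero _ = s∈ξ
  greedy-∈ (suc k) k<n with path-crosses-diagonal (connected s M s∈ξ M∈ξ) (diag (greedy k)) s≤k k<M
    where
    s≤k : diag s ℤ.≤ diag (greedy k)
    s≤k = subst (diag s ℤ.≤_) (sym (diag-greedy k)) (ℤP.i≤i+j (diag s) (+ k))
    k<M : diag (greedy k) ℤ.< diag M
    k<M = subst₂ ℤ._<_ (sym (diag-greedy k)) (sym diag-M) (ℤP.+-monoʳ-< (diag s) (ℤ.+<+ k<n))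
  ... | a , b , a∈ , b∈ , adj , diag-a , diag-b with thin a (greedy k) a∈ (greedy-∈ k (ℕP.<⇒≤ k<n)) diag-a
  ... | refl with adjacent⇒move-or-diag-pred a b adj
  ...   | inj₁ (b′ , refl) = eastward-move-∈ a b′ b∈
  ...   | inj₂ diag-b-pred = ⊥-elim (x+1≢x-1 {diag a} (trans (sym diag-b) diag-b-pred))
    where
    x+1≢x-1 : ∀ {x} → x ℤ.+ ℤ.1ℤ ≢ x ℤ.- ℤ.1ℤ
    x+1≢x-1 {x} eq with ∙-cancelˡ x ℤ.1ℤ ℤ.-1ℤ eq
    ... | ()

  ∈⇒greedy : ∀ u → u ∈ ξ → ∃ λ k → k ≤ n × u ≡ greedy k
  ∈⇒greedy u u∈ with ≤⇒+ℕ (diag s) (diag u) (s-minimal u u∈)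
  ... | k , diag-u = k , k≤n , thin u (greedy k) u∈ (greedy-∈ k k≤n) (trans diag-u (sym (diag-greedy k)))
    where
    k≤n : k ≤ n
    k≤n = ℤP.drop‿+≤+ (ℤ-+-cancelˡ-≤ (diag s) (subst₂ ℤ._≤_ diag-u diag-M (M-maximal u u∈)))

  ribbonWalk : RibbonWalk ξ
  ribbonWalk = record
    { start = s
    ; dir = dir
    ; size = suc n
    ; 1≤size = s≤s z≤n
    ; walk-∈ = λ k k<size → subst (_∈ ξ) (greedy≡walk k) (greedy-∈ k (ℕP.≤-pred k<size))
    ; ∈⇒walk = λ u u∈ → let (k , k≤n , u≡) = ∈⇒greedy u u∈ in k , s≤s k≤n , trans u≡ (greedy≡walk k)
    }

ribbonWalk : (ξ : List Node) → IsRibbon ξ → RibbonWalk ξ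
ribbonWalk ξ (nonempty , thin , connected , _)
  with diag-minimum ξ nonempty | diag-maximum ξ nonempty
... | s , s∈ξ , s-minimal | M , M∈ξ , M-maximal =
  GreedyWalk.ribbonWalk ξ thin connected s s∈ξ s-minimal M M∈ξ M-maximal

-- Contents of walk segments

interval : ℕ → ℕ → List ℕ
interval i zero = []
interval i (suc n) = i ∷ interval (suc i) n

∈-interval⁻ : ∀ {i n k} → k ∈ interval i n → i ≤ k × k ℕ.< i ℕ.+ n
∈-interval⁻ {i} {suc n} (here refl) = ℕP.≤-refl , ℕP.m<m+n i (s≤s z≤n)
∈-interval⁻ {i} {suc n} {k} (there k∈) with ∈-interval⁻ {suc i} {n} k∈
... | i<k , k<i+1+n = ℕP.<⇒≤ i<k , subst (k ℕ.<_) (sym (ℕP.+-suc i n)) k<i+1+n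

∈-interval⁺ : ∀ {i n k} → i ≤ k → k ℕ.< i ℕ.+ n → k ∈ interval i n
∈-interval⁺ {i} {zero} {k} i≤k k<i+0 = ⊥-elim (ℕP.<⇒≱ k<i+0 (subst (ℕ._≤ k) (sym (ℕP.+-identityʳ i)) i≤k))
∈-interval⁺ {i} {suc n} {k} i≤k k<i+n with i ℕ.≟ k
... | yes refl = here refl
... | no i≢k = there (∈-interval⁺ (ℕP.≤∧≢⇒< i≤k i≢k) (subst (k ℕ.<_) (ℕP.+-suc i n) k<i+n))

interval-unique : ∀ i n → Unique (interval i n)
interval-unique i zero = AllPairs.[]
interval-unique i (suc n) =
  All.tabulate (λ k∈ i≡k → ℕP.<⇒≢ (proj₁ (∈-interval⁻ k∈)) i≡k) AllPairs.∷ interval-unique (suc i) n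

segment : Node → (ℕ → Bool) → ℕ → ℕ → List Node
segment s dir i n = List.map (walk s dir) (interval i n)

segment-unique : ∀ s dir i n → Unique (segment s dir i n)
segment-unique s dir i n = UniqueP.map⁺ (walk-injective s dir) (interval-unique i n)

sumᵣ-↭ : {n : ℕ} {A : Set} (f : A → Root n) {xs ys : List A} → xs ↭ ys →
         sumᵣ (List.map f xs) ≡ sumᵣ (List.map f ys)
sumᵣ-↭ f Perm.refl = refl
sumᵣ-↭ f (Perm.prep x p) = cong (f x +ᵣ_) (sumᵣ-↭ f p)
sumᵣ-↭ f (Perm.swap x y p) = begin
  f x +ᵣ (f y +ᵣ _)      ≡⟨ +ᵣ-assoc (f x) (f y) _ ⟨
  (f x +ᵣ f y) +ᵣ _      ≡⟨ cong₂ _+ᵣ_ (+ᵣ-comm (f x) (f y)) (sumᵣ-↭ f p) ⟩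
  (f y +ᵣ f x) +ᵣ _      ≡⟨ +ᵣ-assoc (f y) (f x) _ ⟩
  f y +ᵣ (f x +ᵣ _)      ∎
  where open ≡-Reasoning
sumᵣ-↭ f (Perm.trans p q) = trans (sumᵣ-↭ f p) (sumᵣ-↭ f q)

module WalkContent (m : ℕ) where
  open Cyclic m

  cont-≡ : (xs ys : List Node) → Unique xs → Unique ys → (∀ {u} → u ∈ xs → u ∈ ys) → (∀ {u} → u ∈ ys → u ∈ xs) →
           cont {e} xs ≡ cont ys
  cont-≡ xs ys xs-unique ys-unique xs⊆ys ys⊆xs =
    sumᵣ-↭ (λ u → αs (res u)) (∼bag⇒↭ (unique∧set⇒bag xs-unique ys-unique (mk⇔ xs⊆ys ys⊆xs)))

  res-walk : ∀ s dir k → res (walk s dir k) ≡ shift (res s) k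
  res-walk s dir k = trans (cong residue (diag-walk s dir k)) (residue-+ (diag s) k)

  cont-segment : ∀ s dir i n → cont {e} (segment s dir i n) ≡ α (shift (res s) i) n
  cont-segment s dir i zero = refl
  cont-segment s dir i (suc n) = begin
    αs (res (walk s dir i)) +ᵣ cont (segment s dir (suc i) n)   ≡⟨ cong₂ _+ᵣ_ (cong αs (res-walk s dir i)) (cont-segment s dir (suc i) n) ⟩
    αs (shift (res s) i) +ᵣ α (shift (res s) (suc i)) n          ≡⟨ cong (λ t → αs (shift (res s) i) +ᵣ α t n) (sym shift-i-1) ⟩
    αs (shift (res s) i) +ᵣ α (shift (shift (res s) i) 1) n      ≡⟨ α-suc (shift (res s) i) n ⟨
    α (shift (res s) i) (suc n)                                  ∎
    where
    open ≡-Reasoning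
    shift-i-1 : shift (shift (res s) i) 1 ≡ shift (res s) (suc i)
    shift-i-1 = trans (shift-shift (res s) i 1) (cong (shift (res s)) (ℕP.+-comm i 1))

  module _ {ξ : List Node} (rw : RibbonWalk ξ) where
    open RibbonWalk rw

    ξ≡segment : (∀ {u} → u ∈ ξ → u ∈ segment start dir 0 size) × (∀ {u} → u ∈ segment start dir 0 size → u ∈ ξ)
    ξ≡segment = ξ⊆ , ⊆ξ
      where
      ξ⊆ : ∀ {u} → u ∈ ξ → u ∈ segment start dir 0 size
      ξ⊆ {u} u∈ with ∈⇒walk u u∈
      ... | k , k<size , refl = ∈-map⁺ (walk start dir) (∈-interval⁺ z≤n k<size)
      ⊆ξ : ∀ {u} → u ∈ segment start dir 0 size → u ∈ ξ
      ⊆ξ u∈ with ∈-map⁻ (walk start dir) u∈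
      ... | k , k∈ , refl = walk-∈ k (proj₂ (∈-interval⁻ k∈))

    cont-ribbonWalk : Unique ξ → cont {e} ξ ≡ α (res start) size
    cont-ribbonWalk ξ-unique =
      trans (cont-≡ ξ _ ξ-unique (segment-unique start dir 0 size) (proj₁ ξ≡segment) (proj₂ ξ≡segment))
            (trans (cont-segment start dir 0 size) (cong (λ t → α t size) (shift-zero (res start))))

  cont-ribbon-posRoot : (ξ : List Node) → IsRibbon ξ → IsPosRoot {e} (cont ξ)
  cont-ribbon-posRoot ξ ribbon = res start , size , 1≤size , cont-ribbonWalk rw (proj₁ (proj₂ (proj₂ (proj₂ ribbon))))
    where
    rw = ribbonWalk ξ ribbon
    open RibbonWalk rw

-- Segments of a ribbon entered by an east move and left by a north move

EnteredEastward : (ℕ → Bool) → ℕ → Set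
EnteredEastward dir i = (i ≡ 0) ⊎ (∃ λ i′ → i ≡ suc i′ × dir i′ ≡ true)

LeftNorthward : (ℕ → Bool) → ℕ → ℕ → Set
LeftNorthward dir size j = (j ≡ size) ⊎ (∃ λ j′ → j ≡ suc j′ × dir j′ ≡ false)

module Segment (m : ℕ) (P : ConvexPreorder (suc m)) {ξ : List Node} (ξ-skew : IsSkewShape ξ) (rw : RibbonWalk ξ)
               (i n : ℕ) (1≤n : 1 ≤ n) (i+n≤size : i ℕ.+ n ≤ RibbonWalk.size rw)
               (entered : EnteredEastward (RibbonWalk.dir rw) i)
               (left : LeftNorthward (RibbonWalk.dir rw) (RibbonWalk.size rw) (i ℕ.+ n))
               (proper : ¬ (i ≡ 0 × i ℕ.+ n ≡ RibbonWalk.size rw)) where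
  open RibbonWalk rw

  p : ℕ → Node
  p = walk start dir

  ν : List Node
  ν = segment start dir i n

  ∈ν⁺ : ∀ {k} → i ≤ k → k ℕ.< i ℕ.+ n → p k ∈ ν
  ∈ν⁺ i≤k k<i+n = ∈-map⁺ p (∈-interval⁺ i≤k k<i+n)

  ∈ν⁻ : ∀ {k} → p k ∈ ν → i ≤ k × k ℕ.< i ℕ.+ n
  ∈ν⁻ {k} pk∈ with ∈-map⁻ p pk∈
  ... | l , l∈ , pk≡pl with walk-injective start dir {k} {l} pk≡pl
  ... | refl = ∈-interval⁻ l∈

  ν⊆ξ : ∀ {u} → u ∈ ν → u ∈ ξ
  ν⊆ξ u∈ with ∈-map⁻ p u∈
  ... | l , l∈ , refl = walk-∈ l (ℕP.<-≤-trans (proj₂ (∈-interval⁻ l∈)) i+n≤size)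

  ν-not-↘-outside : ∀ u v → u ∈ ν → v ∈ ξ → ¬ (v ∈ ν) → ¬ (u ↘ v)
  ν-not-↘-outside u v u∈ v∈ v∉ u↘v with ∈-map⁻ p u∈ | ∈⇒walk v v∈
  ... | l , l∈ , refl | k , k<size , refl with ∈-interval⁻ l∈
  ... | i≤l , l<i+n with k ℕ.<? i
  ...   | yes k<i = before entered k<i
    where
    before : EnteredEastward dir i → k ℕ.< i → ⊥
    before (inj₁ refl) ()
    before (inj₂ (i′ , refl , dir-i′)) (s≤s k≤i′) = east-between⇒¬↘ start dir k≤i′ i≤l dir-i′ u↘v
  ...   | no k≮i with k ℕ.<? i ℕ.+ n
  ...     | yes k<i+n = v∉ (∈ν⁺ (ℕP.≮⇒≥ k≮i) k<i+n)
  ...     | no k≮i+n = after left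
    where
    after : LeftNorthward dir size (i ℕ.+ n) → ⊥
    after (inj₁ i+n≡size) = k≮i+n (subst (k ℕ.<_) (sym i+n≡size) k<size)
    after (inj₂ (j′ , i+n≡1+j′ , dir-j′)) =
      north-between⇒¬↘ start dir (ℕP.≤-pred (subst (l ℕ.<_) i+n≡1+j′ l<i+n))
                                  (subst (ℕ._≤ k) i+n≡1+j′ (ℕP.≮⇒≥ k≮i+n)) dir-j′ u↘v

  ν-skew : IsSkewShape ν
  ν-skew = segment-unique start dir i n , convex
    where
    convex : ∀ u v w → u ∈ ν → w ∈ ν → u ↘ v → v ↘ w → v ∈ ν
    convex u v w u∈ w∈ u↘v v↘w with mem? _≟N_ v ν
    ... | yes v∈ = v∈
    ... | no v∉ = ⊥-elim (ν-not-↘-outside u v u∈ (proj₂ ξ-skew u v w (ν⊆ξ u∈) (ν⊆ξ w∈) u↘v v↘w) v∉ u↘v)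

  outside : List Node
  outside = ξ ∖ ν

  ∈outside⁺ : ∀ {u} → u ∈ ξ → ¬ (u ∈ ν) → u ∈ outside
  ∈outside⁺ = ∈-filter⁺ (λ u → ¬? (mem? _≟N_ u ν))

  ∈outside⁻ : ∀ {u} → u ∈ outside → u ∈ ξ × ¬ (u ∈ ν)
  ∈outside⁻ = ∈-filter⁻ (λ u → ¬? (mem? _≟N_ u ν))

  outside-skew : IsSkewShape outside
  outside-skew = UniqueP.filter⁺ (λ u → ¬? (mem? _≟N_ u ν)) (proj₁ ξ-skew) , convex
    where
    convex : ∀ u v w → u ∈ outside → w ∈ outside → u ↘ v → v ↘ w → v ∈ outside
    convex u v w u∈ w∈ u↘v v↘w with mem? _≟N_ v ν
    ... | yes v∈ = ⊥-elim (ν-not-↘-outside v w v∈ (proj₁ (∈outside⁻ w∈)) (proj₂ (∈outside⁻ w∈)) v↘w)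
    ... | no v∉ = ∈outside⁺ (proj₂ ξ-skew u v w (proj₁ (∈outside⁻ u∈)) (proj₁ (∈outside⁻ w∈)) u↘v v↘w) v∉

  witness-outside : ∃ λ u → u ∈ ξ × ¬ (u ∈ ν)
  witness-outside with i ℕ.≟ 0
  ... | yes i≡0 = p n , walk-∈ n n<size , λ pn∈ → ℕP.<-irrefl (sym (cong (ℕ._+ n) i≡0)) (proj₂ (∈ν⁻ pn∈))
    where
    n<size : n ℕ.< size
    n<size = ℕP.≤∧≢⇒< (subst (λ x → x ℕ.+ n ≤ size) i≡0 i+n≤size) (λ n≡size → proper (i≡0 , trans (cong (ℕ._+ n) i≡0) n≡size))
  ... | no i≢0 = p 0 , walk-∈ 0 1≤size , λ p0∈ → i≢0 (ℕP.n≤0⇒n≡0 (proj₁ (∈ν⁻ p0∈)))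

  ν⊊ξ : ν ⊊ ξ
  ν⊊ξ = ν⊆ξ , λ ξ⊆ν → let (u , u∈ξ , u∉ν) = witness-outside in u∉ν (ξ⊆ν u∈ξ)

  ν-removable : IsSERemovable P ξ ν
  ν-removable = ν-skew , ν⊆ξ , inj₂ tableau
    where
    partition : ∀ u → (u ∈ ξ) ⇔ (u ∈ outside ⊎ u ∈ ν)
    partition u = mk⇔ split join
      where
      split : u ∈ ξ → u ∈ outside ⊎ u ∈ ν
      split u∈ with mem? _≟N_ u ν
      ... | yes u∈ν = inj₂ u∈ν
      ... | no u∉ν = inj₁ (∈outside⁺ u∈ u∉ν)
      join : u ∈ outside ⊎ u ∈ ν → u ∈ ξ
      join (inj₁ u∈) = proj₁ (∈outside⁻ u∈)
      join (inj₂ u∈) = ν⊆ξ u∈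
    tableau : IsTableau P ξ outside ν
    tableau = outside-skew , ν-skew ,
              (let (u , u∈ξ , u∉ν) = witness-outside in u , ∈outside⁺ u∈ξ u∉ν) ,
              (p i , ∈ν⁺ ℕP.≤-refl (ℕP.m<m+n i 1≤n)) ,
              (λ u (u∈outside , u∈ν) → proj₂ (∈outside⁻ u∈outside) u∈ν) ,
              partition ,
              (λ u v u∈ν v∈outside → ν-not-↘-outside u v u∈ν (proj₁ (∈outside⁻ v∈outside)) (proj₂ (∈outside⁻ v∈outside)))

  path-forward : ∀ a d → i ≤ a → a ℕ.+ d ℕ.< i ℕ.+ n → Path ν (p a) (p (a ℕ.+ d))
  path-forward a zero i≤a a<i+n = subst (λ x → Path ν (p a) (p x)) (sym (ℕP.+-identityʳ a))
    (here (∈ν⁺ i≤a (subst (ℕ._< i ℕ.+ n) (ℕP.+-identityʳ a) a<i+n)))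
  path-forward a (suc d) i≤a a+d<i+n =
    step (∈ν⁺ i≤a (ℕP.≤-<-trans (ℕP.m≤m+n a (suc d)) a+d<i+n)) (adjacent-move (dir a) (p a))
      (subst (λ x → Path ν (p (suc a)) (p x)) (sym (ℕP.+-suc a d))
        (path-forward (suc a) d (ℕP.m≤n⇒m≤1+n i≤a) (subst (ℕ._< i ℕ.+ n) (ℕP.+-suc a d) a+d<i+n)))

  path-backward : ∀ a d → i ≤ a → a ℕ.+ d ℕ.< i ℕ.+ n → Path ν (p (a ℕ.+ d)) (p a)
  path-backward a zero i≤a a<i+n = subst (λ x → Path ν (p x) (p a)) (sym (ℕP.+-identityʳ a))
    (here (∈ν⁺ i≤a (subst (ℕ._< i ℕ.+ n) (ℕP.+-identityʳ a) a<i+n)))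
  path-backward a (suc d) i≤a a+d<i+n = subst (λ x → Path ν (p x) (p a)) (sym (ℕP.+-suc a d))
    (step (∈ν⁺ (ℕP.m≤n⇒m≤1+n (ℕP.≤-trans i≤a (ℕP.m≤m+n a d))) (subst (ℕ._< i ℕ.+ n) (ℕP.+-suc a d) a+d<i+n))
          (adjacent-move⁻¹ (dir (a ℕ.+ d)) (p (a ℕ.+ d)))
          (path-backward a d i≤a (ℕP.<-trans (ℕP.+-monoʳ-< a (ℕP.n<1+n d)) a+d<i+n)))

  ν-connected : IsConnected ν
  ν-connected u v u∈ v∈ with ∈-map⁻ p u∈ | ∈-map⁻ p v∈
  ... | a , a∈ , refl | b , b∈ , refl with ℕP.≤-total a b
  ...   | inj₁ a≤b with ℕP.m≤n⇒∃[o]m+o≡n a≤b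
  ...     | d , refl = path-forward a d (proj₁ (∈-interval⁻ a∈)) (proj₂ (∈-interval⁻ b∈))
  ν-connected u v u∈ v∈ | a , a∈ , refl | b , b∈ , refl | inj₂ b≤a with ℕP.m≤n⇒∃[o]m+o≡n b≤a
  ...     | d , refl = path-backward b d (proj₁ (∈-interval⁻ b∈)) (proj₂ (∈-interval⁻ a∈))

  ν-thin : IsThin ν
  ν-thin u v u∈ v∈ diag-u≡diag-v with ∈-map⁻ p u∈ | ∈-map⁻ p v∈
  ... | a , _ , refl | b , _ , refl = cong p (ℤP.+-injective (∙-cancelˡ (diag start) (+ a) (+ b)
    (trans (sym (diag-walk start dir a)) (trans diag-u≡diag-v (diag-walk start dir b)))))

  ν-ribbon : IsRibbon ν
  ν-ribbon = (p i , ∈ν⁺ ℕP.≤-refl (ℕP.m<m+n i 1≤n)) , ν-thin , ν-connected , ν-skew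

-- Decomposing a labelled interval into maximal runs

module LabelledRuns {d : ℕ} (label : ℕ → Bool) (N : ℕ) (f : ℕ → Root d) where

  interval-sum : ℕ → ℕ → Root d
  interval-sum a n = sumᵣ (List.map f (interval a n))

  Constant : Bool → ℕ → ℕ → Set
  Constant c a r = ∀ k → a ≤ k → k ℕ.< a ℕ.+ r → label k ≡ c

  constant-suc : ∀ {c a r} → Constant c a (suc r) → Constant c (suc a) r
  constant-suc {a = a} {r} const k a<k k<a+r = const k (ℕP.<⇒≤ a<k) (subst (k ℕ.<_) (sym (ℕP.+-suc a r)) k<a+r)

  constant-first : ∀ {c a r} → 1 ≤ r → Constant c a r → label a ≡ c
  constant-first {a = a} 1≤r const = const a ℕP.≤-refl (ℕP.m<m+n a 1≤r)

  constant-last : ∀ {c a r} → 1 ≤ r → Constant c a r → ∃ λ j → a ℕ.+ r ≡ suc j × label j ≡ c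
  constant-last {a = a} {suc r} _ const =
    a ℕ.+ r , ℕP.+-suc a r , const (a ℕ.+ r) (ℕP.m≤m+n a r) (subst (a ℕ.+ r ℕ.<_) (sym (ℕP.+-suc a r)) ℕP.≤-refl)

  constant-singleton : ∀ a → Constant (label a) a 1
  constant-singleton a k a≤k k<a+1 = cong label (ℕP.≤-antisym (ℕP.≤-pred (subst (k ℕ.<_) (ℕP.+-comm a 1) k<a+1)) a≤k)

  run-from : ∀ a n → ∃ λ r → 1 ≤ r × r ≤ suc n × Constant (label a) a r × (r ≡ suc n ⊎ label (a ℕ.+ r) ≢ label a)
  run-from a zero = 1 , s≤s z≤n , s≤s z≤n , constant-singleton a , inj₁ refl
  run-from a (suc n) with label (suc a) BoolP.≟ label a
  ... | no next≢ = 1 , s≤s z≤n , s≤s z≤n , constant-singleton a ,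
                   inj₂ (subst (λ z → label z ≢ label a) (ℕP.+-comm 1 a) next≢)
  ... | yes next≡ with run-from (suc a) n
  ...   | r , 1≤r , r≤1+n , const , end = suc r , s≤s z≤n , s≤s r≤1+n , const′ , end′ end
    where
    const′ : Constant (label a) a (suc r)
    const′ k a≤k k<a+1+r with a ℕ.≟ k
    ... | yes refl = refl
    ... | no a≢k = trans (const k (ℕP.≤∧≢⇒< a≤k a≢k) (subst (k ℕ.<_) (ℕP.+-suc a r) k<a+1+r)) next≡
    end′ : r ≡ suc n ⊎ label (suc a ℕ.+ r) ≢ label (suc a) → suc r ≡ suc (suc n) ⊎ label (a ℕ.+ suc r) ≢ label a
    end′ (inj₁ r≡1+n) = inj₁ (cong suc r≡1+n)
    end′ (inj₂ end≢) = inj₂ (λ eq → end≢ (trans (cong label (sym (ℕP.+-suc a r))) (trans eq (sym next≡))))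

  RunBoundary : ℕ → Set
  RunBoundary a = (a ≡ 0) ⊎ (∃ λ a′ → a ≡ suc a′ × label a′ ≢ label a)

  boundary-after-run : ∀ a r → 1 ≤ r → Constant (label a) a r → label (a ℕ.+ r) ≢ label a → RunBoundary (a ℕ.+ r)
  boundary-after-run a (suc r) _ const end≢ = inj₂ (a ℕ.+ r , ℕP.+-suc a r , λ eq → end≢ (trans (sym eq) last))
    where
    last : label (a ℕ.+ r) ≡ label a
    last = const (a ℕ.+ r) (ℕP.m≤m+n a r) (subst (a ℕ.+ r ℕ.<_) (sym (ℕP.+-suc a r)) ℕP.≤-refl)

  module _ (b : Bool) where

    labelled-sum : ℕ → ℕ → Root d
    labelled-sum a n = sumᵣ (List.map f (List.filter (λ k → label k BoolP.≟ b) (interval a n)))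

    labelled-sum-+ : ∀ a x y → labelled-sum a (x ℕ.+ y) ≡ labelled-sum a x +ᵣ labelled-sum (a ℕ.+ x) y
    labelled-sum-+ a zero y = trans (cong (λ z → labelled-sum z y) (sym (ℕP.+-identityʳ a))) (sym (+ᵣ-identityˡ _))
    labelled-sum-+ a (suc x) y with label a BoolP.≟ b
    ... | yes _ = trans (cong (f a +ᵣ_) rest) (sym (+ᵣ-assoc (f a) _ _))
      where
      rest : labelled-sum (suc a) (x ℕ.+ y) ≡ labelled-sum (suc a) x +ᵣ labelled-sum (a ℕ.+ suc x) y
      rest = trans (labelled-sum-+ (suc a) x y) (cong (λ z → labelled-sum (suc a) x +ᵣ labelled-sum z y) (sym (ℕP.+-suc a x)))
    ... | no _ = trans (labelled-sum-+ (suc a) x y) (cong (λ z → labelled-sum (suc a) x +ᵣ labelled-sum z y) (sym (ℕP.+-suc a x)))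

    labelled-sum-constant : ∀ a r → Constant b a r → labelled-sum a r ≡ interval-sum a r
    labelled-sum-constant a zero _ = refl
    labelled-sum-constant a (suc r) const with label a BoolP.≟ b
    ... | yes _ = cong (f a +ᵣ_) (labelled-sum-constant (suc a) r (constant-suc const))
    ... | no label≢b = ⊥-elim (label≢b (const a ℕP.≤-refl (ℕP.m<m+n a (s≤s z≤n))))

    labelled-sum-other : ∀ a r c → c ≢ b → Constant c a r → labelled-sum a r ≡ 0ᵣ
    labelled-sum-other a zero c _ _ = refl
    labelled-sum-other a (suc r) c c≢b const with label a BoolP.≟ b
    ... | yes label≡b = ⊥-elim (c≢b (trans (sym (const a ℕP.≤-refl (ℕP.m<m+n a (s≤s z≤n)))) label≡b))
    ... | no _ = labelled-sum-other (suc a) r c c≢b (constant-suc const)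

    MaximalRun : ℕ → ℕ → Set
    MaximalRun a r = 1 ≤ r × a ℕ.+ r ≤ N × Constant b a r ×
                     ((a ≡ 0) ⊎ (∃ λ a′ → a ≡ suc a′ × label a′ ≢ b)) ×
                     ((a ℕ.+ r ≡ N) ⊎ (label (a ℕ.+ r) ≢ b))

    constant-relabel : ∀ {a r} → Constant (label a) a r → label a ≡ b → Constant b a r
    constant-relabel const label≡b k a≤k k<a+r = trans (const k a≤k k<a+r) label≡b

    maximal-run : ∀ a r n → RunBoundary a → 1 ≤ r → r ≤ suc n → a ℕ.+ suc n ≡ N → Constant (label a) a r →
                  (r ≡ suc n ⊎ label (a ℕ.+ r) ≢ label a) → label a ≡ b → MaximalRun a r
    maximal-run a r n boundary 1≤r r≤1+n a+n≡N const end label≡b =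
      1≤r , subst (a ℕ.+ r ≤_) a+n≡N (ℕP.+-monoʳ-≤ a r≤1+n) , constant-relabel const label≡b , start boundary , stop end
      where
      start : RunBoundary a → (a ≡ 0) ⊎ (∃ λ a′ → a ≡ suc a′ × label a′ ≢ b)
      start (inj₁ a≡0) = inj₁ a≡0
      start (inj₂ (a′ , a≡1+a′ , label≢)) = inj₂ (a′ , a≡1+a′ , λ eq → label≢ (trans eq (sym label≡b)))
      stop : (r ≡ suc n ⊎ label (a ℕ.+ r) ≢ label a) → (a ℕ.+ r ≡ N) ⊎ (label (a ℕ.+ r) ≢ b)
      stop (inj₁ r≡1+n) = inj₁ (trans (cong (a ℕ.+_) r≡1+n) a+n≡N)
      stop (inj₂ end≢) = inj₂ (λ eq → end≢ (trans eq (sym label≡b)))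

    labelled-sum-runs : (G : Root d → Set) → (∀ a r → MaximalRun a r → G (interval-sum a r)) →
                        ∃ λ rs → All G rs × labelled-sum 0 N ≡ sumᵣ rs
    labelled-sum-runs G G-run = go N 0 N ℕP.≤-refl refl (inj₁ (inj₁ refl))
      where
      go : ∀ fuel a n → n ≤ fuel → a ℕ.+ n ≡ N → RunBoundary a ⊎ n ≡ 0 →
           ∃ λ rs → All G rs × labelled-sum a n ≡ sumᵣ rs
      go _ a zero _ _ _ = [] , [] , refl
      go _ a (suc n) _ _ (inj₂ ())
      go (suc fuel) a (suc n) (s≤s n≤fuel) a+n≡N (inj₁ boundary)
        with run-from a n
      ... | r , 1≤r , r≤1+n , const , end with ℕP.m≤n⇒∃[o]m+o≡n r≤1+n
      ...   | rest , r+rest≡1+n with go fuel (a ℕ.+ r) rest rest≤fuel a+r+rest≡N (boundary′ end)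
        where
        rest≤fuel : rest ≤ fuel
        rest≤fuel = ℕP.≤-trans (ℕP.≤-pred (subst (suc rest ≤_) r+rest≡1+n (ℕP.+-monoˡ-≤ rest 1≤r))) n≤fuel
        a+r+rest≡N : a ℕ.+ r ℕ.+ rest ≡ N
        a+r+rest≡N = trans (ℕP.+-assoc a r rest) (trans (cong (a ℕ.+_) r+rest≡1+n) a+n≡N)
        boundary′ : (r ≡ suc n ⊎ label (a ℕ.+ r) ≢ label a) → RunBoundary (a ℕ.+ r) ⊎ rest ≡ 0
        boundary′ (inj₁ r≡1+n) = inj₂ (ℕP.+-cancelˡ-≡ r rest 0 (trans r+rest≡1+n (trans (sym r≡1+n) (sym (ℕP.+-identityʳ r)))))
        boundary′ (inj₂ end≢) = inj₁ (boundary-after-run a r 1≤r const end≢)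
      ...     | rs , G-rs , rest-sum = include-run (label a BoolP.≟ b)
        where
        split : labelled-sum a (suc n) ≡ labelled-sum a r +ᵣ labelled-sum (a ℕ.+ r) rest
        split = trans (cong (labelled-sum a) (sym r+rest≡1+n)) (labelled-sum-+ a r rest)
        include-run : Dec (label a ≡ b) → ∃ λ rs′ → All G rs′ × labelled-sum a (suc n) ≡ sumᵣ rs′
        include-run (yes label≡b) =
          interval-sum a r ∷ rs , G-run a r (maximal-run a r n boundary 1≤r r≤1+n a+n≡N const end label≡b) ∷ G-rs ,
          trans split (cong₂ _+ᵣ_ (labelled-sum-constant a r (constant-relabel const label≡b)) rest-sum)
        include-run (no label≢b) = rs , G-rs , trans split
          (trans (cong (_+ᵣ labelled-sum (a ℕ.+ r) rest) (labelled-sum-other a r (label a) label≢b const))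
                 (trans (+ᵣ-identityˡ _) rest-sum))

module Backward (m : ℕ) (P : ConvexPreorder (suc m)) {ξ : List Node} (ξ-ribbon : IsRibbon ξ)
  (removable-above : (ν : List Node) → IsRibbon ν → IsSERemovable P ξ ν → ν ⊊ ξ →
                     ConvexPreorder._≻_ P (cont ν) (cont ξ)) where
  open Cyclic m
  open ConvexOrder m P
  open ConvexPreorder P
  open WalkContent m

  ξ-skew : IsSkewShape ξ
  ξ-skew = proj₂ (proj₂ (proj₂ ξ-ribbon))

  rw : RibbonWalk ξ
  rw = ribbonWalk ξ ξ-ribbon
  open RibbonWalk rw

  p : ℕ → Node
  p = walk start dir

  t : Fin e
  t = res start

  β : Root e
  β = cont ξ

  pβ : IsPosRoot β
  pβ = cont-ribbon-posRoot ξ ξ-ribbon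

  β≡α : β ≡ α t size
  β≡α = cont-ribbonWalk rw (proj₁ ξ-skew)

  α-posRoot : ∀ a r → 1 ≤ r → IsPosRoot (α (shift t a) r)
  α-posRoot a r 1≤r = shift t a , r , 1≤r , refl

  segment-above : ∀ i n → 1 ≤ n → i ℕ.+ n ≤ size → EnteredEastward dir i → LeftNorthward dir size (i ℕ.+ n) →
                  ¬ (i ≡ 0 × i ℕ.+ n ≡ size) → α (shift t i) n ≻ β
  segment-above i n 1≤n i+n≤size entered left proper =
    subst (_≻ β) (cont-segment start dir i n) (removable-above ν ν-ribbon ν-removable ν⊊ξ)
    where open Segment m P ξ-skew rw i n 1≤n i+n≤size entered left proper

  β-split : ∀ a r b → a ℕ.+ r ℕ.+ b ≡ size → β ≡ α t a +ᵣ (α (shift t a) r +ᵣ α (shift t (a ℕ.+ r)) b)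
  β-split a r b a+r+b≡size = begin
    β                                                             ≡⟨ β≡α ⟩
    α t size                                                      ≡⟨ cong (α t) (trans (sym a+r+b≡size) (ℕP.+-assoc a r b)) ⟩
    α t (a ℕ.+ (r ℕ.+ b))                                         ≡⟨ α-+ t a (r ℕ.+ b) ⟩
    α t a +ᵣ α (shift t a) (r ℕ.+ b)                              ≡⟨ cong (α t a +ᵣ_) (α-+ (shift t a) r b) ⟩
    α t a +ᵣ (α (shift t a) r +ᵣ α (shift (shift t a) r) b)       ≡⟨ cong (λ u → α t a +ᵣ (α (shift t a) r +ᵣ α u b)) (shift-shift t a r) ⟩
    α t a +ᵣ (α (shift t a) r +ᵣ α (shift t (a ℕ.+ r)) b)         ∎
    where open ≡-Reasoning

  prefix-above : ∀ j → suc j ℕ.< size → dir j ≡ false → α t (suc j) ≻ β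
  prefix-above j 1+j<size dir-j = subst (λ u → α u (suc j) ≻ β) (shift-zero t)
    (segment-above 0 (suc j) (s≤s z≤n) (ℕP.<⇒≤ 1+j<size) (inj₁ refl) (inj₂ (j , refl , dir-j))
                   (λ (_ , 1+j≡size) → ℕP.<-irrefl 1+j≡size 1+j<size))

  suffix-above : ∀ j n → 1 ≤ n → suc j ℕ.+ n ≡ size → dir j ≡ true → α (shift t (suc j)) n ≻ β
  suffix-above j n 1≤n 1+j+n≡size dir-j =
    segment-above (suc j) n 1≤n (ℕP.≤-reflexive 1+j+n≡size) (inj₂ (j , refl , dir-j)) (inj₁ 1+j+n≡size) (λ ())

  module Tableau (λ₁ λ₂ : List Node) (tableau : IsTableau P ξ λ₁ λ₂) where
    λ₁-skew : IsSkewShape λ₁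
    λ₁-skew = proj₁ tableau
    λ₂-skew : IsSkewShape λ₂
    λ₂-skew = proj₁ (proj₂ tableau)
    λ₁-nonempty : NonEmpty λ₁
    λ₁-nonempty = proj₁ (proj₂ (proj₂ tableau))
    λ₂-nonempty : NonEmpty λ₂
    λ₂-nonempty = proj₁ (proj₂ (proj₂ (proj₂ tableau)))
    disjoint : ∀ u → ¬ (u ∈ λ₁ × u ∈ λ₂)
    disjoint = proj₁ (proj₂ (proj₂ (proj₂ (proj₂ tableau))))
    partition : ∀ u → (u ∈ ξ) ⇔ (u ∈ λ₁ ⊎ u ∈ λ₂)
    partition = proj₁ (proj₂ (proj₂ (proj₂ (proj₂ (proj₂ tableau)))))
    λ₂-not-↘-λ₁ : ∀ u v → u ∈ λ₂ → v ∈ λ₁ → ¬ (u ↘ v)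
    λ₂-not-↘-λ₁ = proj₂ (proj₂ (proj₂ (proj₂ (proj₂ (proj₂ tableau)))))

    label : ℕ → Bool
    label k = does (mem? _≟N_ (p k) λ₂)

    label-true⇒∈λ₂ : ∀ k → label k ≡ true → p k ∈ λ₂
    label-true⇒∈λ₂ k label≡true with mem? _≟N_ (p k) λ₂ | label≡true
    ... | yes pk∈ | _ = pk∈
    ... | no _ | ()

    label-false⇒∈λ₁ : ∀ k → k ℕ.< size → label k ≡ false → p k ∈ λ₁
    label-false⇒∈λ₁ k k<size label≡false with Equivalence.to (partition (p k)) (walk-∈ k k<size)
    ... | inj₁ pk∈λ₁ = pk∈λ₁
    ... | inj₂ pk∈λ₂ with trans (sym (dec-true (mem? _≟N_ (p k) λ₂) pk∈λ₂)) label≡false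
    ...   | ()

    ∈λ₂⇒label-true : ∀ k → p k ∈ λ₂ → label k ≡ true
    ∈λ₂⇒label-true k = dec-true (mem? _≟N_ (p k) λ₂)

    ∈λ₁⇒label-false : ∀ k → p k ∈ λ₁ → label k ≡ false
    ∈λ₁⇒label-false k pk∈λ₁ = dec-false (mem? _≟N_ (p k) λ₂) (λ pk∈λ₂ → disjoint (p k) (pk∈λ₁ , pk∈λ₂))

    rise⇒east : ∀ k → suc k ℕ.< size → label k ≡ false → label (suc k) ≡ true → dir k ≡ true
    rise⇒east k 1+k<size label-k label-1+k = BoolP.¬-not λ dir-k → λ₂-not-↘-λ₁ (p (suc k)) (p k)
      (label-true⇒∈λ₂ (suc k) label-1+k) (label-false⇒∈λ₁ k (ℕP.<-trans (ℕP.n<1+n k) 1+k<size) label-k)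
      (north-move-↘ start dir k dir-k)

    fall⇒north : ∀ k → suc k ℕ.< size → label k ≡ true → label (suc k) ≡ false → dir k ≡ false
    fall⇒north k 1+k<size label-k label-1+k = BoolP.¬-not λ dir-k → λ₂-not-↘-λ₁ (p k) (p (suc k))
      (label-true⇒∈λ₂ k label-k) (label-false⇒∈λ₁ (suc k) 1+k<size label-1+k)
      (east-move-↘ start dir k dir-k)

    f : ℕ → Root e
    f k = αs (res (p k))

    open LabelledRuns label size f
      using (interval-sum; labelled-sum; Constant; constant-first; constant-last; MaximalRun; labelled-sum-runs)

    interval-sum≡α : ∀ a r → interval-sum a r ≡ α (shift t a) r
    interval-sum≡α a r = trans (cong sumᵣ (ListP.map-∘ {g = λ u → αs (res u)} {f = p} (interval a r))) (cont-segment start dir a r)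

    cont-labelled : ∀ b (λb : List Node) → Unique λb → (∀ {u} → u ∈ λb → u ∈ ξ) →
                    (∀ k → p k ∈ λb → label k ≡ b) → (∀ k → k ℕ.< size → label k ≡ b → p k ∈ λb) →
                    cont λb ≡ labelled-sum b 0 size
    cont-labelled b λb λb-unique λb⊆ξ labelled unlabelled =
      trans (cont-≡ λb (List.map p ks) λb-unique ks-unique λb⊆ ⊆λb) (cong sumᵣ (sym (ListP.map-∘ {g = λ u → αs (res u)} {f = p} ks)))
      where
      label? : ∀ k → Dec (label k ≡ b)
      label? k = label k BoolP.≟ b
      ks : List ℕ
      ks = List.filter label? (interval 0 size)
      ks-unique : Unique (List.map p ks)
      ks-unique = UniqueP.map⁺ (walk-injective start dir) (UniqueP.filter⁺ label? (interval-unique 0 size))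
      λb⊆ : ∀ {u} → u ∈ λb → u ∈ List.map p ks
      λb⊆ u∈ with ∈⇒walk _ (λb⊆ξ u∈)
      ... | k , k<size , refl = ∈-map⁺ p (∈-filter⁺ label? (∈-interval⁺ z≤n k<size) (labelled k u∈))
      ⊆λb : ∀ {u} → u ∈ List.map p ks → u ∈ λb
      ⊆λb u∈ with ∈-map⁻ p u∈
      ... | k , k∈ , refl with ∈-filter⁻ label? k∈
      ... | k∈interval , label≡b = unlabelled k (proj₂ (∈-interval⁻ k∈interval)) label≡b

    cont-λ₂ : cont λ₂ ≡ labelled-sum true 0 size
    cont-λ₂ = cont-labelled true λ₂ (proj₁ λ₂-skew) (λ u∈ → Equivalence.from (partition _) (inj₂ u∈))
                            ∈λ₂⇒label-true (λ k _ → label-true⇒∈λ₂ k)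

    cont-λ₁ : cont λ₁ ≡ labelled-sum false 0 size
    cont-λ₁ = cont-labelled false λ₁ (proj₁ λ₁-skew) (λ u∈ → Equivalence.from (partition _) (inj₁ u∈))
                            ∈λ₁⇒label-false label-false⇒∈λ₁

    label-other-than : ∀ b → ∃ λ k → k ℕ.< size × label k ≡ not b
    label-other-than true with λ₁-nonempty
    ... | u , u∈λ₁ with ∈⇒walk u (Equivalence.from (partition u) (inj₁ u∈λ₁))
    ...   | k , k<size , refl = k , k<size , ∈λ₁⇒label-false k u∈λ₁
    label-other-than false with λ₂-nonempty
    ... | u , u∈λ₂ with ∈⇒walk u (Equivalence.from (partition u) (inj₂ u∈λ₂))
    ...   | k , k<size , refl = k , k<size , ∈λ₂⇒label-true k u∈λ₂

    constant-not-everything : ∀ {b r} → Constant b 0 r → r ≢ size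
    constant-not-everything {b} const refl with label-other-than b
    ... | k , k<size , label-k = BoolP.not-¬ (const k z≤n k<size) label-k

    true-run-above : ∀ a r → MaximalRun true a r → Above β (α (shift t a) r)
    true-run-above a r (1≤r , a+r≤size , const , start , stop) =
      α-posRoot a r 1≤r , segment-above a r 1≤r a+r≤size (entered start) (left stop) proper
      where
      a<size : a ℕ.< size
      a<size = ℕP.<-≤-trans (ℕP.m<m+n a 1≤r) a+r≤size
      entered : (a ≡ 0) ⊎ (∃ λ a′ → a ≡ suc a′ × label a′ ≢ true) → EnteredEastward dir a
      entered (inj₁ a≡0) = inj₁ a≡0
      entered (inj₂ (a′ , refl , label≢true)) =
        inj₂ (a′ , refl , rise⇒east a′ a<size (BoolP.¬-not label≢true) (constant-first 1≤r const))
      left : (a ℕ.+ r ≡ size) ⊎ (label (a ℕ.+ r) ≢ true) → LeftNorthward dir size (a ℕ.+ r)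
      left (inj₁ a+r≡size) = inj₁ a+r≡size
      left (inj₂ label≢true) with a ℕ.+ r ℕ.≟ size | constant-last 1≤r const
      ... | yes a+r≡size | _ = inj₁ a+r≡size
      ... | no a+r≢size | j , a+r≡1+j , label-j = inj₂ (j , a+r≡1+j ,
            fall⇒north j (subst (ℕ._< size) a+r≡1+j (ℕP.≤∧≢⇒< a+r≤size a+r≢size)) label-j
                         (subst (λ x → label x ≡ false) a+r≡1+j (BoolP.¬-not label≢true)))
      proper : ¬ (a ≡ 0 × a ℕ.+ r ≡ size)
      proper (refl , r≡size) = constant-not-everything const r≡size

    false-run-within : ∀ {a r} → MaximalRun false a r → a ℕ.< size
    false-run-within {a} (1≤r , a+r≤size , _) = ℕP.<-≤-trans (ℕP.m<m+n a 1≤r) a+r≤size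

    prefix-before-false-run-above : ∀ j r → MaximalRun false (suc j) r → label j ≢ false → α t (suc j) ≻ β
    prefix-before-false-run-above j r run@(1≤r , _ , const , _) label≢false =
      prefix-above j (false-run-within run)
        (fall⇒north j (false-run-within run) (BoolP.¬-not label≢false) (constant-first 1≤r const))

    suffix-after-false-run-above : ∀ a r b → MaximalRun false a r → a ℕ.+ r ℕ.+ suc b ≡ size →
                                   α (shift t (a ℕ.+ r)) (suc b) ≻ β
    suffix-after-false-run-above a r b (_ , _ , _ , _ , inj₁ a+r≡size) a+r+1+b≡size =
      ⊥-elim (ℕP.m+1+n≢m (a ℕ.+ r) (trans a+r+1+b≡size (sym a+r≡size)))
    suffix-after-false-run-above a r b (1≤r , _ , const , _ , inj₂ label≢false) a+r+1+b≡size
      with constant-last 1≤r const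
    ... | j , a+r≡1+j , label-j = subst (λ c → α (shift t c) (suc b) ≻ β) (sym a+r≡1+j)
      (suffix-above j (suc b) (s≤s z≤n) 1+j+1+b≡size
        (rise⇒east j 1+j<size label-j (subst (λ x → label x ≡ true) a+r≡1+j (BoolP.¬-not label≢false))))
      where
      1+j+1+b≡size : suc j ℕ.+ suc b ≡ size
      1+j+1+b≡size = trans (cong (ℕ._+ suc b) (sym a+r≡1+j)) a+r+1+b≡size
      1+j<size : suc j ℕ.< size
      1+j<size = subst (suc j ℕ.<_) 1+j+1+b≡size (ℕP.m<m+n (suc j) (s≤s z≤n))

    -- β = A + D + B with D the run; the nonempty ones among A and B are SE-removable segments.
    β≻false-run : ∀ a r b → MaximalRun false a r → a ℕ.+ r ℕ.+ b ≡ size → β ≻ α (shift t a) r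
    β≻false-run a r zero (_ , _ , const , inj₁ refl , _) r+0≡size =
      ⊥-elim (constant-not-everything const (trans (sym (ℕP.+-identityʳ r)) r+0≡size))
    β≻false-run a r zero run@(1≤r , _ , _ , inj₂ (j , refl , label≢false) , _) a+r+0≡size =
      summand-above⇒summand-below pβ (t , a , s≤s z≤n , refl) (α-posRoot a r 1≤r)
        (trans (β-split a r 0 a+r+0≡size) (cong (α t a +ᵣ_) (+ᵣ-identityʳ _)))
        (prefix-before-false-run-above j r run label≢false)
    β≻false-run a r (suc b) run@(1≤r , _ , _ , inj₁ refl , _) r+1+b≡size =
      summand-above⇒summand-below pβ (α-posRoot r (suc b) (s≤s z≤n)) (α-posRoot 0 r 1≤r)
        (trans (β-split 0 r (suc b) r+1+b≡size) (trans (+ᵣ-identityˡ _) (+ᵣ-comm _ _)))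
        (suffix-after-false-run-above 0 r b run r+1+b≡size)
    β≻false-run a r (suc b) run@(1≤r , _ , _ , inj₂ (j , refl , label≢false) , _) a+r+1+b≡size =
      middle-below pβ (t , a , s≤s z≤n , refl) (α-posRoot a r 1≤r) (α-posRoot (a ℕ.+ r) (suc b) (s≤s z≤n))
        (subst IsPosRoot α-split (α-posRoot a (r ℕ.+ suc b) (ℕP.≤-trans 1≤r (ℕP.m≤m+n r (suc b)))))
        (β-split a r (suc b) a+r+1+b≡size)
        (prefix-before-false-run-above j r run label≢false)
        (suffix-after-false-run-above a r b run a+r+1+b≡size)
      where
      α-split : α (shift t a) (r ℕ.+ suc b) ≡ α (shift t a) r +ᵣ α (shift t (a ℕ.+ r)) (suc b)
      α-split = trans (α-+ (shift t a) r (suc b)) (cong (λ u → α (shift t a) r +ᵣ α u (suc b)) (shift-shift t a r))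

    false-run-below : ∀ a r → MaximalRun false a r → Below β (α (shift t a) r)
    false-run-below a r run@(1≤r , a+r≤size , _) with ℕP.m≤n⇒∃[o]m+o≡n a+r≤size
    ... | b , a+r+b≡size = α-posRoot a r 1≤r , β≻false-run a r b run a+r+b≡size

    λ₂-above : SumOf P (Above β) (cont λ₂)
    λ₂-above =
      let (rs , above , sum≡) = labelled-sum-runs true (Above β) λ a r run →
                                  subst (Above β) (sym (interval-sum≡α a r)) (true-run-above a r run)
      in rs , above , trans cont-λ₂ sum≡

    λ₁-below : SumOf P (Below β) (cont λ₁)
    λ₁-below =
      let (rs , below , sum≡) = labelled-sum-runs false (Below β) λ a r run →
                                  subst (Below β) (sym (interval-sum≡α a r)) (false-run-below a r run)
      in rs , below , trans cont-λ₁ sum≡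

  cuspidal : IsCuspidal P ξ
  cuspidal = ξ-skew , pβ , λ λ₁ λ₂ tableau → Tableau.λ₁-below λ₁ λ₂ tableau , Tableau.λ₂-above λ₁ λ₂ tableau

cuspidal⇒removable-above : (m : ℕ) (P : ConvexPreorder (suc m)) {ξ : List Node} → IsCuspidal P ξ →
                           (ν : List Node) → IsRibbon ν → IsSERemovable P ξ ν → ν ⊊ ξ →
                           ConvexPreorder._≻_ P (cont ν) (cont ξ)
cuspidal⇒removable-above m P (_ , _ , _) ν _ (_ , _ , inj₁ ν≡ξ) (_ , ξ⊈ν) =
  ⊥-elim (ξ⊈ν λ {u} u∈ξ → Equivalence.from (ν≡ξ u) u∈ξ)
cuspidal⇒removable-above m P {ξ} (_ , pβ , tableau-sums) ν ν-ribbon (_ , _ , inj₂ tableau) _ =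
  let (rs , above , cont-ν≡) = proj₂ (tableau-sums (ξ ∖ ν) ν tableau)
  in subst (_≻ cont ξ) (sym cont-ν≡)
       (sum-of-above⇒above pβ rs above (subst IsPosRoot cont-ν≡ (cont-ribbon-posRoot ν ν-ribbon)))
  where
  open ConvexPreorder P
  open ConvexOrder m P
  open WalkContent m

lemma5p5 : (e : ℕ) .{{_ : NonZero e}} → 2 ≤ e → (P : ConvexPreorder e) →
    (ξ : List Node) → IsRibbon ξ →
    IsCuspidal P ξ ⇔
      ((ν : List Node) → IsRibbon ν → IsSERemovable P ξ ν → ν ⊊ ξ →
        ConvexPreorder._≻_ P (cont ν) (cont ξ))
lemma5p5 (suc m) _ P ξ ξ-ribbon = mk⇔ (cuspidal⇒removable-above m P) (Backward.cuspidal m P ξ-ribbon)
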